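{- Let $N=\prod_{i=1}^n p_i$ be square-free with divisors $d_1<\dots<d_s$ ($s=2^n$) in the total order described in the context, and let $M\neq1$ be a divisor of $N$. Let $\Lambda$ be the $s\times s$ matrix $\Lambda_{ij}=\frac{1}{24}a_N(d_i,d_j)$ with $a_N(a,b)=\frac{N}{(a,N/a)}\frac{(a,b)^2}{ab}$, and let $C$ be the $s\times 1$ column vector with $C_{a1}=(-1)^{\omega(d_a)}$ if $d_a\mid M$ and $C_{a1}=0$ otherwise. Let $E:=\Lambda^{ -1}C$. Then for $1\le a\le s$, $$E_{a1}=\mathrm{sgn}(d_{s+1-a})\cdot\frac{24}{\varphi(N)\psi(N/M)}\cdot\frac{d_{s+1-a}}{(d_{s+1-a},M)}.$$ In particular $E_{s1}=(-1)^{\omega(N)}\frac{24}{\varphi(N)\psi(N/M)}$, and if $M=N$ then $E_{a1}=\mathrm{sgn}(d_{s+1-a})\frac{24}{\varphi(N)}$.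
   Context: Each divisor $a$ of $N$ is identified with $(a_1,\dots,a_n)\in\{0,1\}^n$, $a_i=1$ iff $p_i\mid a$. Order: for $a\ne b$, $a<b$ if $\omega(a)<\omega(b)$; if $\omega(a)=\omega(b)$, $a<b$ iff at the first index $t$ with $a_t\ne b_t$ one has $a_t>b_t$. $\omega$ = number of distinct prime factors; $\mathrm{sgn}(a)=(-1)^{\omega(N)-\omega(a)}$. $\varphi(K)=\prod_{p\mid K}(p-1)$, $\psi(K)=\prod_{p\mid K}(p+1)$ for square-free $K$; $(x,y)$ denotes gcd. -}

module Defs where

open import Data.Nat as ℕ using (ℕ; zero; suc; _∸_)
open import Data.Nat.Divisibility using (_∣_; _∣?_)
open import Data.Nat.DivMod as ND using ()
open import Data.Nat.GCD using (gcd)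
open import Data.Nat.Primality using (Prime; prime?)
open import Data.Integer as ℤ using (+_)
open import Data.Rational as ℚ using (ℚ; 0ℚ; 1ℚ; -_; _+_; _*_)
open import Data.Fin as Fin using (Fin; zero; suc; _≟_)
open import Data.List as List using (List; filter; length; upTo)
import Data.Nat.ListAction as LA
open import Data.Bool using (Bool; true; false; if_then_else_)
open import Data.Product using (Σ; ∃; _×_; _,_)
open import Relation.Nullary using (yes; no; _×-dec_)
open import Relation.Binary.PropositionalEquality using (_≡_)

prodFin : ∀ {n} → (Fin n → ℕ) → ℕ
prodFin {zero}  f = 1
prodFin {suc n} f = f zero ℕ.* prodFin (λ i → f (suc i))

sumQ : ∀ {k} → (Fin k → ℚ) → ℚ
sumQ {zero}  f = 0ℚ
sumQ {suc k} f = f zero + sumQ (λ i → f (suc i))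

Matrix : ℕ → ℕ → Set
Matrix m k = Fin m → Fin k → ℚ

_⊗_ : ∀ {m k l} → Matrix m k → Matrix k l → Matrix m l
(A ⊗ B) i j = sumQ (λ t → A i t * B t j)

identity : ∀ {m} → Matrix m m
identity i j with i ≟ j
... | yes _ = 1ℚ
... | no  _ = 0ℚ

-- x / y in ℚ (y is always a nonzero natural in our uses; value 0 if y = 0)
divQ : ℕ → ℕ → ℚ
divQ x zero    = 0ℚ
divQ x (suc y) = (+ x) ℚ./ suc y

-- natural-number quotient x / y (exact in our uses; 0 if y = 0)
ndiv : ℕ → ℕ → ℕ
ndiv x zero    = 0
ndiv x (suc y) = x ND./ suc y

primeDivisors : ℕ → List ℕ
primeDivisors a = filter (λ q → prime? q ×-dec q ∣? a) (upTo (suc a))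

ω : ℕ → ℕ
ω a = length (primeDivisors a)

φ : ℕ → ℕ
φ K = LA.product (List.map (λ q → q ∸ 1) (primeDivisors K))

ψ : ℕ → ℕ
ψ K = LA.product (List.map (λ q → q ℕ.+ 1) (primeDivisors K))

negOnePow : ℕ → ℚ
negOnePow zero    = 1ℚ
negOnePow (suc k) = - negOnePow k

sgn : (N a : ℕ) → ℚ
sgn N a = negOnePow (ω N ∸ ω a)

bit : ∀ {n} → (Fin n → ℕ) → ℕ → Fin n → Bool
bit p a i with p i ∣? a
... | yes _ = true
... | no  _ = false

_≺⟨_⟩_ : ∀ {n} → ℕ → (Fin n → ℕ) → ℕ → Set
a ≺⟨ p ⟩ b =
  (ω a ℕ.< ω b)
  Data.Sum.⊎
  (ω a ≡ ω b × ∃ λ t → bit p a t ≡ true × bit p b t ≡ false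
                      × (∀ u → u Fin.< t → bit p a u ≡ bit p b u))
  where import Data.Sum

aN : ℕ → ℕ → ℕ → ℚ
aN N a b = divQ N (gcd a (ndiv N a)) * divQ (gcd a b ℕ.^ 2) (a ℕ.* b)

Λ : ∀ {s} → ℕ → (Fin s → ℕ) → Matrix s s
Λ N d i j = divQ 1 24 * aN N (d i) (d j)

Cvec : ∀ {s} → ℕ → (Fin s → ℕ) → Matrix s 1
Cvec M d a _ with d a ∣? M
... | yes _ = negOnePow (ω (d a))
... | no  _ = 0ℚ

Eformula : ∀ {s} → ℕ → ℕ → (Fin s → ℕ) → Fin s → ℚ
Eformula N M d a =
  sgn N (d (Fin.opposite a))
  * divQ 24 (φ N ℕ.* ψ (ndiv N M))
  * divQ (d (Fin.opposite a)) (gcd (d (Fin.opposite a)) M)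

{-# OPTIONS --safe #-}
-- A divisor of N = p₁⋯pₙ is identified with its bit vector b, d = ∏ pᵢ^bᵢ.  Complementing the
-- bits (d ↦ N/d) reverses the order, so d_{s+1-a} = N/d_a.  Since (a, N/a) = 1,
-- a_N(a,c) = N ∏ᵢ pᵢ^-(aᵢ xor cᵢ), and sgn(N/c) and (N/c)/((N/c),M) factor over the primes as well;
-- so (ΛE)_α is a constant times a sum over bit vectors c of a product over i, that is, a product
-- over i of two-term sums.  The i-th sum is (-1)^αᵢ (pᵢ-1)(pᵢ+1)^[pᵢ∤M]/pᵢ when αᵢ ≤ μᵢ and 0
-- otherwise, and the constants cancel against 24/(φ(N)ψ(N/M)); hence ΛE = C, and a left inverse
-- of Λ maps C to E.
module Submission where

open import Data.Nat using (ℕ; _^_)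
open import Data.Nat.Divisibility using (_∣_)
open import Data.Nat.Primality using (Prime)
import Data.Fin as Fin
open import Data.Fin using (Fin)
open import Data.Bool using (Bool)
open import Data.Product using (∃)
open import Relation.Binary.PropositionalEquality using (_≡_)
open import Algebra.Structures using (IsCommutativeMonoid)
open import Defs

module ≡-CommutativeMonoidSums {A : Set} {_∙_ : A → A → A} {ε : A}
                                (isCM : IsCommutativeMonoid _≡_ _∙_ ε) where

  open import Data.Nat as ℕ using (zero; suc; _<_)
  open import Data.Fin using (zero; suc; toℕ; fromℕ<)
  open import Data.Fin.Properties using (punchInᵢ≢i; toℕ-fromℕ<; toℕ-injective)
  open import Data.Bool using (true; false; if_then_else_)
  open import Data.List using (foldr; map; filter; applyUpTo)
  open import Function using (_∘_)
  open import Level using (0ℓ)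
  open import Algebra.Bundles using (CommutativeMonoid)
  open import Relation.Nullary using (does)
  open import Relation.Nullary.Decidable using (dec-true; dec-false)
  open import Relation.Unary using (Pred; Decidable)
  open import Relation.Binary.PropositionalEquality
  import Algebra.Properties.CommutativeMonoid.Sum as Sum

  open IsCommutativeMonoid isCM using (identityˡ; identityʳ)
  commutativeMonoid : CommutativeMonoid 0ℓ 0ℓ
  commutativeMonoid = record { isCommutativeMonoid = isCM }

  open Sum commutativeMonoid public using (sum; sum-cong-≗; ∑-comm; ∑-distrib-+; sum-permute)
  open Sum commutativeMonoid using (sum-remove; sum-replicate-zero)

  when : Bool → A → A
  when x a = if x then a else ε

  when-cong : ∀ x {a a′} → (x ≡ true → a ≡ a′) → when x a ≡ when x a′
  when-cong true  a≡a′ = a≡a′ refl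
  when-cong false a≡a′ = refl

  when-vanishes : ∀ x {a} → (x ≡ true → a ≡ ε) → when x a ≡ ε
  when-vanishes true  a≡ε = a≡ε refl
  when-vanishes false a≡ε = refl

  sum-ε : ∀ {n} (f : Fin n → A) → (∀ i → f i ≡ ε) → sum f ≡ ε
  sum-ε {n} f f≗ε = trans (sum-cong-≗ f≗ε) (sum-replicate-zero n)

  sum-when : ∀ {n} x (f : Fin n → A) → sum (λ i → when x (f i)) ≡ when x (sum f)
  sum-when true  f = refl
  sum-when false f = sum-ε (λ i → when false (f i)) (λ _ → refl)

  sum-single : ∀ {n} (f : Fin n → A) i → (∀ j → j ≢ i → f j ≡ ε) → sum f ≡ f i
  sum-single {suc n} f i others = begin
    sum f                                   ≡⟨ sum-remove {i = i} f ⟩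
    f i ∙ sum (λ k → f (Fin.punchIn i k))   ≡⟨ cong (f i ∙_) (sum-ε _ (λ k → others _ (punchInᵢ≢i i k))) ⟩
    f i ∙ ε                                 ≡⟨ identityʳ (f i) ⟩
    f i                                     ∎
    where open ≡-Reasoning

  sum-toℕ≟ : ∀ {m c} (a : A) → c < m → sum {m} (λ j → when (does (toℕ j ℕ.≟ c)) a) ≡ a
  sum-toℕ≟ {m} {c} a c<m =
    trans (sum-single (λ j → when (does (toℕ j ℕ.≟ c)) a) (fromℕ< c<m) off)
          (cong (λ x → when x a) (dec-true (_ ℕ.≟ c) (toℕ-fromℕ< c<m)))
    where
    off : ∀ (j : Fin m) → j ≢ fromℕ< c<m → when (does (toℕ j ℕ.≟ c)) a ≡ ε
    off j j≢ = cong (λ x → when x a) (dec-false (toℕ j ℕ.≟ c)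
                 (λ j≡c → j≢ (toℕ-injective (trans j≡c (sym (toℕ-fromℕ< c<m))))))

  foldr-filter-applyUpTo : ∀ {ℓ} {P : Pred ℕ ℓ} (P? : Decidable P) (g : ℕ → A) f m →
    foldr _∙_ ε (map g (filter P? (applyUpTo f m)))
      ≡ sum {m} (λ j → when (does (P? (f (toℕ j)))) (g (f (toℕ j))))
  foldr-filter-applyUpTo P? g f zero = refl
  foldr-filter-applyUpTo P? g f (suc m) with does (P? (f 0))
  ... | true  = cong (g (f 0) ∙_) (foldr-filter-applyUpTo P? g (f ∘ suc) m)
  ... | false = trans (foldr-filter-applyUpTo P? g (f ∘ suc) m) (sym (identityˡ _))

module Squarefree where

  open import Data.Nat as ℕ using (zero; suc; _+_; _*_; _∸_; _≤_; _<_; z≤n; s≤s)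
  open import Data.Nat.Properties
  open import Data.Nat.Divisibility
  open import Data.Nat.GCD using (gcd; gcd-greatest; gcd[m,n]∣m; gcd[m,n]∣n)
  open import Data.Nat.Coprimality using (Coprime; coprime-divisor)
  open import Data.Nat.Primality
  open import Data.Nat.DivMod using (_/_; m*n/n≡m)
  open import Data.Fin using (zero; suc; toℕ)
  open import Data.Bool using (true; false; not; _∧_; if_then_else_)
  open import Data.Product using (_×_; _,_; proj₁; proj₂)
  open import Data.Sum using (_⊎_; inj₁; inj₂; [_,_]′)
  open import Data.Empty using (⊥-elim)
  open import Data.List as List using (List; foldr; map; length)
  open import Data.Vec.Functional using (_∷_)
  import Data.Nat.ListAction as ListAction
  open import Function using (_∘_; id; const)
  open import Relation.Nullary using (¬_; yes; no; does; _×-dec_; contradiction)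
  open import Relation.Nullary.Decidable using (dec-true; dec-false)
  open import Relation.Binary.PropositionalEquality
  import Algebra.Properties.CommutativeMonoid.Sum as Sum

  module Σℕ = Sum +-0-commutativeMonoid
  module Πℕ = Sum *-1-commutativeMonoid

  ∏ : ∀ {n} → (Fin n → ℕ) → ℕ
  ∏ = Πℕ.sum

  prodFin≡∏ : ∀ {n} (f : Fin n → ℕ) → prodFin f ≡ ∏ f
  prodFin≡∏ {zero}  f = refl
  prodFin≡∏ {suc n} f = cong (f zero *_) (prodFin≡∏ (f ∘ suc))

  ∏-pos : ∀ {n} (f : Fin n → ℕ) → (∀ i → 0 < f i) → 0 < ∏ f
  ∏-pos {zero}  f pos = s≤s z≤n
  ∏-pos {suc n} f pos = *-mono-≤ (pos zero) (∏-pos (f ∘ suc) (pos ∘ suc))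

  factor∣∏ : ∀ {n} (f : Fin n → ℕ) i → f i ∣ ∏ f
  factor∣∏ f zero    = ∣m⇒∣m*n (∏ (f ∘ suc)) ∣-refl
  factor∣∏ f (suc i) = ∣n⇒∣m*n (f zero) (factor∣∏ (f ∘ suc) i)

  prime∤1 : ∀ {q} → Prime q → ¬ q ∣ 1
  prime∤1 (prime {{nt}} _) q∣1 = ℕ.nonTrivial⇒≢1 {{nt}} (∣1⇒≡1 q∣1)

  prime∣∏⇒∣factor : ∀ {n q} (f : Fin n → ℕ) → Prime q → q ∣ ∏ f → ∃ λ i → q ∣ f i
  prime∣∏⇒∣factor {zero}  f pq q∣1 = ⊥-elim (prime∤1 pq q∣1)
  prime∣∏⇒∣factor {suc n} f pq q∣∏ with euclidsLemma (f zero) (∏ (f ∘ suc)) pq q∣∏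
  ... | inj₁ q∣f₀ = zero , q∣f₀
  ... | inj₂ q∣∏′ with prime∣∏⇒∣factor (f ∘ suc) pq q∣∏′
  ...   | i , q∣fᵢ = suc i , q∣fᵢ

  prime∣prime⇒≡ : ∀ {q r} → Prime q → Prime r → q ∣ r → q ≡ r
  prime∣prime⇒≡ pq pr q∣r with prime⇒irreducible pr q∣r
  ... | inj₁ q≡1 = ⊥-elim (prime∤1 pq (∣-reflexive q≡1))
  ... | inj₂ q≡r = q≡r

  ndiv-*ˡ : ∀ m k → 0 < m → ndiv (m * k) m ≡ k
  ndiv-*ˡ (suc m) k _ = trans (cong (_/ suc m) (*-comm (suc m) k)) (m*n/n≡m k (suc m))

  Bits : ℕ → Set
  Bits n = Fin n → Bool

  _⊆ᵇ_ : ∀ {n} → Bits n → Bits n → Set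
  a ⊆ᵇ b = ∀ i → a i ≡ true → b i ≡ true

  ⊆ᵇ-or-witness : ∀ {n} (a b : Bits n) → a ⊆ᵇ b ⊎ ∃ λ i → a i ≡ true × b i ≡ false
  ⊆ᵇ-or-witness {zero}  a b = inj₁ (λ ())
  ⊆ᵇ-or-witness {suc n} a b with ⊆ᵇ-or-witness (a ∘ suc) (b ∘ suc) | a zero in a₀ | b zero in b₀
  ... | inj₂ (i , aᵢ , bᵢ) | _     | _     = inj₂ (suc i , aᵢ , bᵢ)
  ... | inj₁ _             | true  | false = inj₂ (zero , a₀ , b₀)
  ... | inj₁ a′⊆b′         | true  | true  = inj₁ (λ { zero _ → b₀ ; (suc i) → a′⊆b′ i })
  ... | inj₁ a′⊆b′         | false | _     =
    inj₁ (λ { zero a₀≡true → contradiction (trans (sym a₀) a₀≡true) (λ ()) ; (suc i) → a′⊆b′ i })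

  _^ᵇ_ : ℕ → Bool → ℕ
  q ^ᵇ b = if b then q else 1

  fromBits : ∀ {n} → (Fin n → ℕ) → Bits n → ℕ
  fromBits p b = ∏ (λ i → p i ^ᵇ b i)

  fromBits-cong : ∀ {n} (p : Fin n → ℕ) {b c : Bits n} → (∀ i → b i ≡ c i) → fromBits p b ≡ fromBits p c
  fromBits-cong p b≗c = Πℕ.sum-cong-≗ (λ i → cong (p i ^ᵇ_) (b≗c i))

  fromBits-* : ∀ {n} (p : Fin n → ℕ) (f g h : Bits n) →
    (∀ i → p i ^ᵇ f i * p i ^ᵇ g i ≡ p i ^ᵇ h i) → fromBits p f * fromBits p g ≡ fromBits p h
  fromBits-* p f g h pointwise =
    trans (sym (Πℕ.∑-distrib-+ (λ i → p i ^ᵇ f i) (λ i → p i ^ᵇ g i))) (Πℕ.sum-cong-≗ pointwise)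

  fromBits-*-exchange : ∀ {n} (p : Fin n → ℕ) (f g h k : Bits n) →
    (∀ i → p i ^ᵇ f i * p i ^ᵇ g i ≡ p i ^ᵇ h i * p i ^ᵇ k i) →
    fromBits p f * fromBits p g ≡ fromBits p h * fromBits p k
  fromBits-*-exchange p f g h k pointwise =
    trans (sym (Πℕ.∑-distrib-+ (λ i → p i ^ᵇ f i) (λ i → p i ^ᵇ g i)))
          (trans (Πℕ.sum-cong-≗ pointwise) (Πℕ.∑-distrib-+ (λ i → p i ^ᵇ h i) (λ i → p i ^ᵇ k i)))

  fromBits-none : ∀ {n} (p : Fin n → ℕ) → fromBits p (const false) ≡ 1
  fromBits-none {n} p = Πℕ.sum-replicate-zero n

  ^ᵇ-∧-∧not : ∀ x y q → q ^ᵇ (x ∧ y) * q ^ᵇ (x ∧ not y) ≡ q ^ᵇ x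
  ^ᵇ-∧-∧not true  true  q = *-identityʳ q
  ^ᵇ-∧-∧not true  false q = *-identityˡ q
  ^ᵇ-∧-∧not false y     q = refl

  ^ᵇ-not : ∀ x q → q ^ᵇ x * q ^ᵇ not x ≡ q
  ^ᵇ-not true  q = *-identityʳ q
  ^ᵇ-not false q = *-identityˡ q

  count : ∀ {n} → Bits n → ℕ
  count b = Σℕ.sum (λ i → if b i then 1 else 0)

  count-all : ∀ n → count {n} (const true) ≡ n
  count-all zero    = refl
  count-all (suc n) = cong suc (count-all n)

  count+count-not : ∀ {n} (b : Bits n) → count b + count (not ∘ b) ≡ n
  count+count-not {zero}  b = refl
  count+count-not {suc n} b with b zero
  ... | true  = cong suc (count+count-not (b ∘ suc))
  ... | false = trans (+-suc (count (b ∘ suc)) _) (cong suc (count+count-not (b ∘ suc)))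

  count≤n : ∀ {n} (b : Bits n) → count b ≤ n
  count≤n b = subst (count b ≤_) (count+count-not b) (m≤m+n _ _)

  count-not : ∀ {n} (b : Bits n) → count (not ∘ b) ≡ n ∸ count b
  count-not {n} b = sym (trans (cong (_∸ count b) (sym (count+count-not b))) (m+n∸m≡n (count b) _))

  count≡0⇒none : ∀ {n} (b : Bits n) → count b ≡ 0 → ∀ i → b i ≡ false
  count≡0⇒none {suc n} b count≡0 i with b zero in b₀
  count≡0⇒none {suc n} b ()      i       | true
  count≡0⇒none {suc n} b count≡0 zero    | false = b₀
  count≡0⇒none {suc n} b count≡0 (suc i) | false = count≡0⇒none (b ∘ suc) count≡0 i

  length≡sum-map-1 : ∀ {A : Set} (xs : List A) → length xs ≡ ListAction.sum (map (const 1) xs)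
  length≡sum-map-1 List.[]       = refl
  length≡sum-map-1 (x List.∷ xs) = cong suc (length≡sum-map-1 xs)

  divisor⇒fromBits : ∀ {n} (p : Fin n → ℕ) → (∀ i → Prime (p i)) →
    ∀ x → x ∣ prodFin p → ∃ λ b → x ≡ fromBits p b
  divisor⇒fromBits {zero}  p p-prime x x∣1 = (λ ()) , ∣1⇒≡1 x∣1
  divisor⇒fromBits {suc n} p p-prime x x∣N with p zero ∣? x
  ... | yes (divides y x≡yp₀) =
    let instance _ = prime⇒nonZero (p-prime zero)
        x≡p₀y = trans x≡yp₀ (*-comm y (p zero))
        y∣N′ = *-cancelˡ-∣ (p zero) (subst (_∣ prodFin p) x≡p₀y x∣N)
        (b , y≡⟦b⟧) = divisor⇒fromBits (p ∘ suc) (p-prime ∘ suc) y y∣N′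
    in true ∷ b , trans x≡p₀y (cong (p zero *_) y≡⟦b⟧)
  ... | no p₀∤x =
    let x⊥p₀ : Coprime x (p zero)
        x⊥p₀ = λ (k∣x , k∣p₀) →
          [ (λ k≡1 → k≡1) , (λ k≡p₀ → ⊥-elim (p₀∤x (subst (_∣ x) k≡p₀ k∣x))) ]′
            (prime⇒irreducible (p-prime zero) k∣p₀)
        (b , x≡⟦b⟧) = divisor⇒fromBits (p ∘ suc) (p-prime ∘ suc) x (coprime-divisor x⊥p₀ x∣N)
    in false ∷ b , trans x≡⟦b⟧ (sym (*-identityˡ _))

  module Distinct {n} (p : Fin n → ℕ) (p-prime : ∀ i → Prime (p i))
                      (p-injective : ∀ i j → p i ≡ p j → i ≡ j) where

    ⟦_⟧ : Bits n → ℕ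
    ⟦_⟧ = fromBits p

    N : ℕ
    N = prodFin p

    N≡⟦all⟧ : N ≡ ⟦ const true ⟧
    N≡⟦all⟧ = prodFin≡∏ p

    ⟦⟧-pos : ∀ b → 0 < ⟦ b ⟧
    ⟦⟧-pos b = ∏-pos _ (λ i → pos (b i) i)
      where
      pos : ∀ x i → 0 < p i ^ᵇ x
      pos true  i = ℕ.>-nonZero⁻¹ (p i) {{prime⇒nonZero (p-prime i)}}
      pos false i = s≤s z≤n

    p∣⟦⟧ : ∀ b i → b i ≡ true → p i ∣ ⟦ b ⟧
    p∣⟦⟧ b i bᵢ = ∣-trans (∣-reflexive (cong (p i ^ᵇ_) (sym bᵢ))) (factor∣∏ (λ j → p j ^ᵇ b j) i)

    prime∣⟦⟧ : ∀ b {q} → Prime q → q ∣ ⟦ b ⟧ → ∃ λ i → b i ≡ true × q ≡ p i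
    prime∣⟦⟧ b pq q∣⟦b⟧ with prime∣∏⇒∣factor (λ i → p i ^ᵇ b i) pq q∣⟦b⟧
    ... | i , q∣pᵢ^bᵢ = i , lemma (b i) q∣pᵢ^bᵢ
      where
      lemma : ∀ x → _ ∣ p i ^ᵇ x → x ≡ true × _ ≡ p i
      lemma true  q∣pᵢ = refl , prime∣prime⇒≡ pq (p-prime i) q∣pᵢ
      lemma false q∣1  = ⊥-elim (prime∤1 pq q∣1)

    p∣⟦⟧⇒ : ∀ b i → p i ∣ ⟦ b ⟧ → b i ≡ true
    p∣⟦⟧⇒ b i pᵢ∣⟦b⟧ with prime∣⟦⟧ b (p-prime i) pᵢ∣⟦b⟧
    ... | j , bⱼ , pᵢ≡pⱼ = subst (λ k → b k ≡ true) (sym (p-injective i j pᵢ≡pⱼ)) bⱼ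

    bit-⟦⟧ : ∀ b i → bit p ⟦ b ⟧ i ≡ b i
    bit-⟦⟧ b i with p i ∣? ⟦ b ⟧
    ... | yes pᵢ∣⟦b⟧ = sym (p∣⟦⟧⇒ b i pᵢ∣⟦b⟧)
    ... | no pᵢ∤⟦b⟧ with b i in bᵢ
    ...   | true  = ⊥-elim (pᵢ∤⟦b⟧ (p∣⟦⟧ b i bᵢ))
    ...   | false = refl

    ⟦bit⟧ : ∀ x → x ∣ N → ⟦ bit p x ⟧ ≡ x
    ⟦bit⟧ x x∣N with divisor⇒fromBits p p-prime x x∣N
    ... | b , refl = fromBits-cong p (bit-⟦⟧ b)

    ⊆⇒∣ : ∀ a b → a ⊆ᵇ b → ⟦ a ⟧ ∣ ⟦ b ⟧
    ⊆⇒∣ a b a⊆b = divides ⟦ (λ i → b i ∧ not (a i)) ⟧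
      (sym (trans (*-comm _ ⟦ a ⟧) (fromBits-* p a _ b (λ i → split (a i) (b i) (a⊆b i) (p i)))))
      where
      split : ∀ x y → (x ≡ true → y ≡ true) → ∀ q → q ^ᵇ x * q ^ᵇ (y ∧ not x) ≡ q ^ᵇ y
      split true  true  _   q = *-identityʳ q
      split true  false x⇒y q with () ← x⇒y refl
      split false true  _   q = *-identityˡ q
      split false false _   q = refl

    ∣⇒⊆ : ∀ a b → ⟦ a ⟧ ∣ ⟦ b ⟧ → a ⊆ᵇ b
    ∣⇒⊆ a b ⟦a⟧∣⟦b⟧ i aᵢ = p∣⟦⟧⇒ b i (∣-trans (p∣⟦⟧ a i aᵢ) ⟦a⟧∣⟦b⟧)

    ⟦⟧∣N : ∀ a → ⟦ a ⟧ ∣ N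
    ⟦⟧∣N a = subst (⟦ a ⟧ ∣_) (sym N≡⟦all⟧) (⊆⇒∣ a (const true) (λ _ _ → refl))

    gcd-⟦⟧ : ∀ a b → gcd ⟦ a ⟧ ⟦ b ⟧ ≡ ⟦ (λ i → a i ∧ b i) ⟧
    gcd-⟦⟧ a b = ∣-antisym gcd∣⟦a∧b⟧ (gcd-greatest (⊆⇒∣ _ a ∧⊆ˡ) (⊆⇒∣ _ b ∧⊆ʳ))
      where
      ∧⊆ˡ : (λ i → a i ∧ b i) ⊆ᵇ a
      ∧⊆ˡ i eq with a i
      ... | true = refl
      ∧⊆ʳ : (λ i → a i ∧ b i) ⊆ᵇ b
      ∧⊆ʳ i eq with a i
      ... | true = eq
      ⊆∧ : ∀ c → c ⊆ᵇ a → c ⊆ᵇ b → c ⊆ᵇ (λ i → a i ∧ b i)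
      ⊆∧ c c⊆a c⊆b i cᵢ rewrite c⊆a i cᵢ = c⊆b i cᵢ
      gcd∣⟦a∧b⟧ : gcd ⟦ a ⟧ ⟦ b ⟧ ∣ ⟦ (λ i → a i ∧ b i) ⟧
      gcd∣⟦a∧b⟧ with divisor⇒fromBits p p-prime _ (∣-trans (gcd[m,n]∣m ⟦ a ⟧ ⟦ b ⟧) (⟦⟧∣N a))
      ... | c , g≡⟦c⟧ = subst (_∣ _) (sym g≡⟦c⟧) (⊆⇒∣ c _ (⊆∧ c
              (∣⇒⊆ c a (subst (_∣ ⟦ a ⟧) g≡⟦c⟧ (gcd[m,n]∣m ⟦ a ⟧ ⟦ b ⟧)))
              (∣⇒⊆ c b (subst (_∣ ⟦ b ⟧) g≡⟦c⟧ (gcd[m,n]∣n ⟦ a ⟧ ⟦ b ⟧)))))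

    ⟦⟧*⟦not⟧ : ∀ a → ⟦ a ⟧ * ⟦ not ∘ a ⟧ ≡ N
    ⟦⟧*⟦not⟧ a = trans (fromBits-* p a (not ∘ a) (const true) (λ i → ^ᵇ-not (a i) (p i))) (sym N≡⟦all⟧)

    N/⟦⟧ : ∀ a → ndiv N ⟦ a ⟧ ≡ ⟦ not ∘ a ⟧
    N/⟦⟧ a = trans (cong (λ x → ndiv x ⟦ a ⟧) (sym (⟦⟧*⟦not⟧ a))) (ndiv-*ˡ ⟦ a ⟧ _ (⟦⟧-pos a))

    module _ {A : Set} {_∙_ : A → A → A} {ε : A} (isCM : IsCommutativeMonoid _≡_ _∙_ ε)
             (g : ℕ → A) (b : Bits n) where

      open ≡-CommutativeMonoidSums isCM

      match : ℕ → Fin n → A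
      match q i = when (b i) (when (does (q ℕ.≟ p i)) (g (p i)))

      match-non-divisor : ∀ q i → ¬ (Prime q × q ∣ ⟦ b ⟧) → match q i ≡ ε
      match-non-divisor q i ¬q∣⟦b⟧ = when-vanishes (b i) (λ bᵢ → cong (λ x → when x (g (p i)))
        (dec-false (q ℕ.≟ p i) (λ { refl → ¬q∣⟦b⟧ (p-prime i , p∣⟦⟧ b i bᵢ) })))

      match-prime-divisor : ∀ q → when (does (prime? q ×-dec q ∣? ⟦ b ⟧)) (g q) ≡ sum (match q)
      match-prime-divisor q with prime? q | q ∣? ⟦ b ⟧
      ... | no ¬q-prime | _        = sym (sum-ε (match q) (λ i → match-non-divisor q i (¬q-prime ∘ proj₁)))
      ... | yes _       | no q∤⟦b⟧ = sym (sum-ε (match q) (λ i → match-non-divisor q i (q∤⟦b⟧ ∘ proj₂)))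
      ... | yes q-prime | yes q∣⟦b⟧ with prime∣⟦⟧ b q-prime q∣⟦b⟧
      ...   | i , bᵢ , refl = sym (trans (sum-single (match (p i)) i others) hit)
        where
        hit : match (p i) i ≡ g (p i)
        hit = cong₂ (λ x y → when x (when y (g (p i)))) bᵢ (dec-true (p i ℕ.≟ p i) refl)
        others : ∀ j → j ≢ i → match (p i) j ≡ ε
        others j j≢i = when-vanishes (b j) (λ _ → cong (λ x → when x (g (p j)))
                         (dec-false (p i ℕ.≟ p j) (λ pᵢ≡pⱼ → j≢i (p-injective j i (sym pᵢ≡pⱼ)))))

      sum-match : ∀ i → sum (λ (j : Fin (suc ⟦ b ⟧)) → match (toℕ j) i) ≡ when (b i) (g (p i))
      sum-match i = trans (sum-when (b i) (λ (j : Fin (suc ⟦ b ⟧)) → when (does (toℕ j ℕ.≟ p i)) (g (p i))))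
        (when-cong (b i) (λ bᵢ → sum-toℕ≟ (g (p i))
          (s≤s (∣⇒≤ {{ℕ.>-nonZero (⟦⟧-pos b)}} (p∣⟦⟧ b i bᵢ)))))

      foldr-primeDivisors : foldr _∙_ ε (map g (primeDivisors ⟦ b ⟧)) ≡ sum (λ i → when (b i) (g (p i)))
      foldr-primeDivisors = begin
          foldr _∙_ ε (map g (primeDivisors ⟦ b ⟧))
        ≡⟨ foldr-filter-applyUpTo (λ q → prime? q ×-dec q ∣? ⟦ b ⟧) g id (suc ⟦ b ⟧) ⟩
          sum (λ (j : Fin (suc ⟦ b ⟧)) → when (does (prime? (toℕ j) ×-dec toℕ j ∣? ⟦ b ⟧)) (g (toℕ j)))
        ≡⟨ sum-cong-≗ {suc ⟦ b ⟧} (λ j → match-prime-divisor (toℕ j)) ⟩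
          sum (λ (j : Fin (suc ⟦ b ⟧)) → sum (match (toℕ j)))
        ≡⟨ ∑-comm (λ (j : Fin (suc ⟦ b ⟧)) → match (toℕ j)) ⟩
          sum (λ i → sum (λ (j : Fin (suc ⟦ b ⟧)) → match (toℕ j) i))
        ≡⟨ sum-cong-≗ sum-match ⟩
          sum (λ i → when (b i) (g (p i))) ∎
        where open ≡-Reasoning

    ω-⟦⟧ : ∀ b → ω ⟦ b ⟧ ≡ count b
    ω-⟦⟧ b = trans (length≡sum-map-1 (primeDivisors ⟦ b ⟧)) (foldr-primeDivisors +-0-isCommutativeMonoid (const 1) b)

    φ-N : φ N ≡ ∏ (λ i → p i ∸ 1)
    φ-N = trans (cong φ N≡⟦all⟧) (foldr-primeDivisors *-1-isCommutativeMonoid (_∸ 1) (const true))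

    ψ-⟦⟧ : ∀ c → ψ ⟦ c ⟧ ≡ ∏ (λ i → (p i + 1) ^ᵇ c i)
    ψ-⟦⟧ = foldr-primeDivisors *-1-isCommutativeMonoid (_+ 1)

module FinOpposite where

  open import Data.Nat as ℕ using (suc; _∸_; z≤n; s≤s)
  open import Data.Nat.Properties using (≤-<-trans; <-trans; n<1+n; n∸n≡0; ∸-monoʳ-≤; ∸-monoʳ-<)
  open import Function using (_∘′_)
  open import Data.Fin using (toℕ; fromℕ<; opposite; _<_; _≤_)
  open import Data.Fin.Properties using (toℕ<n; toℕ-fromℕ<; ≤-antisym; opposite-prop; opposite-involutive)
  open import Relation.Binary.PropositionalEquality

  StrictlyIncreasing StrictlyDecreasing : ∀ {s} → (Fin s → Fin s) → Set
  StrictlyIncreasing g = ∀ i j → i < j → g i < g j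
  StrictlyDecreasing g = ∀ i j → i < j → g j < g i

  opposite-mono-≤ : ∀ {s} {i j : Fin s} → i ≤ j → opposite j ≤ opposite i
  opposite-mono-≤ {s} {i} {j} i≤j =
    subst₂ ℕ._≤_ (sym (opposite-prop j)) (sym (opposite-prop i)) (∸-monoʳ-≤ s (s≤s i≤j))

  opposite-mono-< : ∀ {s} {i j : Fin s} → i < j → opposite j < opposite i
  opposite-mono-< {s} {i} {j} i<j =
    subst₂ ℕ._<_ (sym (opposite-prop j)) (sym (opposite-prop i)) (∸-monoʳ-< (s≤s i<j) (toℕ<n j))

  increasing⇒≤ : ∀ {s} (g : Fin s → Fin s) → StrictlyIncreasing g → ∀ i → i ≤ g i
  increasing⇒≤ {s} g g↑ i = go (toℕ i) i refl
    where
    go : ∀ m (i : Fin s) → toℕ i ≡ m → m ℕ.≤ toℕ (g i)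
    go ℕ.zero  i _    = z≤n
    go (suc m) i i≡1+m =
      let m<s = <-trans (n<1+n m) (subst (ℕ._< s) i≡1+m (toℕ<n i))
          j<i = subst₂ ℕ._<_ (sym (toℕ-fromℕ< m<s)) (sym i≡1+m) (n<1+n m)
      in ≤-<-trans (go m (fromℕ< m<s) (toℕ-fromℕ< m<s)) (g↑ _ i j<i)

  increasing⇒id : ∀ {s} (g : Fin s → Fin s) → StrictlyIncreasing g → ∀ i → g i ≡ i
  increasing⇒id g g↑ i = ≤-antisym gᵢ≤i (increasing⇒≤ g g↑ i)
    where
    mirrored↑ : StrictlyIncreasing (opposite ∘′ g ∘′ opposite)
    mirrored↑ i j i<j = opposite-mono-< (g↑ _ _ (opposite-mono-< i<j))
    gᵢ≤i : g i ≤ i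
    gᵢ≤i = subst₂ _≤_ (opposite-involutive (g i)) (opposite-involutive i)
             (opposite-mono-≤ (subst (λ k → opposite i ≤ opposite (g k)) (opposite-involutive i)
                                 (increasing⇒≤ _ mirrored↑ (opposite i))))

  opposite-last : ∀ {s} (a : Fin s) → toℕ a ≡ s ∸ 1 → toℕ (opposite a) ≡ 0
  opposite-last {suc s} a a-last =
    trans (opposite-prop a) (trans (cong (λ t → suc s ∸ suc t) a-last) (n∸n≡0 (suc s)))

  decreasing⇒opposite : ∀ {s} (c : Fin s → Fin s) → StrictlyDecreasing c → ∀ j → c j ≡ opposite j
  decreasing⇒opposite c c↓ j =
    trans (cong c (sym (opposite-involutive j)))
          (increasing⇒id (c ∘′ opposite) (λ i k i<k → c↓ _ _ (opposite-mono-< i<k)) (opposite j))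

module DivisorOrder where

  open import Data.Nat as ℕ using (_<_)
  open import Data.Nat.Properties using (<-irrefl; <-asym; ∸-monoʳ-<)
  import Data.Fin.Properties as FinP
  open import Data.Bool using (true; false; not)
  open import Data.Product using (_×_; _,_)
  open import Data.Sum using (_⊎_; inj₁; inj₂)
  open import Function using (_∘_)
  open import Relation.Nullary using (¬_)
  open import Relation.Binary.Definitions using (tri<; tri≈; tri>)
  open import Relation.Binary.PropositionalEquality
  open Squarefree

  ≺-irrefl : ∀ {n} (p : Fin n → ℕ) x → ¬ (x ≺⟨ p ⟩ x)
  ≺-irrefl p x (inj₁ ω<ω)                 = <-irrefl refl ω<ω
  ≺-irrefl p x (inj₂ (_ , t , xₜ , xₜ′ , _)) with () ← trans (sym xₜ) xₜ′

  ≺-asym : ∀ {n} (p : Fin n → ℕ) {x y} → x ≺⟨ p ⟩ y → ¬ (y ≺⟨ p ⟩ x)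
  ≺-asym p (inj₁ x<y)      (inj₁ y<x)      = <-asym x<y y<x
  ≺-asym p (inj₁ x<y)      (inj₂ (y≡x , _)) = <-irrefl (sym y≡x) x<y
  ≺-asym p (inj₂ (x≡y , _)) (inj₁ y<x)      = <-irrefl (sym x≡y) y<x
  ≺-asym p (inj₂ (_ , t , xₜ , yₜ , x≡y<t)) (inj₂ (_ , t′ , yₜ′ , xₜ′ , y≡x<t′)) with FinP.<-cmp t t′
  ... | tri< t<t′ _ _ with () ← trans (sym xₜ) (trans (sym (y≡x<t′ t t<t′)) yₜ)
  ... | tri≈ _ refl _ with () ← trans (sym xₜ) xₜ′
  ... | tri> _ _ t′<t with () ← trans (sym yₜ′) (trans (sym (x≡y<t t′ t′<t)) xₜ′)

  _⊏_ : ∀ {n} → Bits n → Bits n → Set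
  a ⊏ b = count a < count b
        ⊎ (count a ≡ count b × ∃ λ t → a t ≡ true × b t ≡ false × (∀ u → u Fin.< t → a u ≡ b u))

  not-⊏ : ∀ {n} {a b : Bits n} → a ⊏ b → (not ∘ b) ⊏ (not ∘ a)
  not-⊏ {n} {a} {b} (inj₁ a<b) =
    inj₁ (subst₂ _<_ (sym (count-not b)) (sym (count-not a)) (∸-monoʳ-< a<b (count≤n b)))
  not-⊏ {n} {a} {b} (inj₂ (a≡b , t , aₜ , bₜ , a≡b<t)) =
    inj₂ ( trans (count-not b) (trans (cong (n ℕ.∸_) (sym a≡b)) (sym (count-not a)))
         , t , cong not bₜ , cong not aₜ , λ u u<t → cong not (sym (a≡b<t u u<t)))

  module _ {n} (p : Fin n → ℕ) (p-prime : ∀ i → Prime (p i))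
               (p-injective : ∀ i j → p i ≡ p j → i ≡ j) where

    open Distinct p p-prime p-injective

    ≺⇒⊏ : ∀ {a b} → ⟦ a ⟧ ≺⟨ p ⟩ ⟦ b ⟧ → a ⊏ b
    ≺⇒⊏ {a} {b} (inj₁ ω<ω) = inj₁ (subst₂ _<_ (ω-⟦⟧ a) (ω-⟦⟧ b) ω<ω)
    ≺⇒⊏ {a} {b} (inj₂ (ω≡ω , t , aₜ , bₜ , a≡b<t)) =
      inj₂ ( trans (sym (ω-⟦⟧ a)) (trans ω≡ω (ω-⟦⟧ b)) , t
           , trans (sym (bit-⟦⟧ a t)) aₜ , trans (sym (bit-⟦⟧ b t)) bₜ
           , λ u u<t → trans (sym (bit-⟦⟧ a u)) (trans (a≡b<t u u<t) (bit-⟦⟧ b u)))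

    ⊏⇒≺ : ∀ {a b} → a ⊏ b → ⟦ a ⟧ ≺⟨ p ⟩ ⟦ b ⟧
    ⊏⇒≺ {a} {b} (inj₁ a<b) = inj₁ (subst₂ _<_ (sym (ω-⟦⟧ a)) (sym (ω-⟦⟧ b)) a<b)
    ⊏⇒≺ {a} {b} (inj₂ (a≡b , t , aₜ , bₜ , a≡b<t)) =
      inj₂ ( trans (ω-⟦⟧ a) (trans a≡b (sym (ω-⟦⟧ b))) , t
           , trans (bit-⟦⟧ a t) aₜ , trans (bit-⟦⟧ b t) bₜ
           , λ u u<t → trans (bit-⟦⟧ a u) (trans (a≡b<t u u<t) (sym (bit-⟦⟧ b u))))

    ¬≺1 : ∀ {x} → x ∣ N → ¬ (x ≺⟨ p ⟩ 1)
    ¬≺1 x∣N (inj₁ ())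
    ¬≺1 {x} x∣N (inj₂ (ωx≡0 , t , xₜ , _ , _))
      with () ← trans (sym xₜ) (count≡0⇒none (bit p x)
                  (trans (sym (ω-⟦⟧ (bit p x))) (trans (cong ω (⟦bit⟧ x x∣N)) ωx≡0)) t)

    ≺-N/ : ∀ {x y} → x ∣ N → y ∣ N → x ≺⟨ p ⟩ y → ndiv N y ≺⟨ p ⟩ ndiv N x
    ≺-N/ {x} {y} x∣N y∣N x≺y =
      subst₂ _≺⟨ p ⟩_ (sym (N/-bits y y∣N)) (sym (N/-bits x x∣N))
        (⊏⇒≺ (not-⊏ (≺⇒⊏ (subst₂ _≺⟨ p ⟩_ (sym (⟦bit⟧ x x∣N)) (sym (⟦bit⟧ y y∣N)) x≺y))))
      where
      N/-bits : ∀ z → z ∣ N → ndiv N z ≡ ⟦ not ∘ bit p z ⟧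
      N/-bits z z∣N = trans (cong (ndiv N) (sym (⟦bit⟧ z z∣N))) (N/⟦⟧ (bit p z))

module DivisorIndexing {n} (p : Fin n → ℕ) (p-prime : ∀ i → Prime (p i))
    (p-injective : ∀ i j → p i ≡ p j → i ≡ j)
    (d : Fin (2 ^ n) → ℕ) (d∣N : ∀ i → d i ∣ prodFin p)
    (d-onto : ∀ a → a ∣ prodFin p → ∃ λ i → d i ≡ a)
    (d-mono : ∀ i j → i Fin.< j → d i ≺⟨ p ⟩ d j) where

  open import Data.Nat as ℕ using (_*_)
  open import Data.Nat.Properties using (*-identityʳ; n≮0)
  open import Data.Nat.Divisibility using (divides)
  open import Data.Fin using (toℕ; opposite; _<_)
  import Data.Fin.Properties as FinP
  open import Data.Product using (_,_; proj₁; proj₂)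
  open import Data.Empty using (⊥-elim)
  open import Relation.Binary.Definitions using (tri<; tri≈; tri>)
  open import Relation.Binary.PropositionalEquality

  open Squarefree
  open Distinct p p-prime p-injective
  open DivisorOrder
  open FinOpposite using (decreasing⇒opposite)

  bitsOf : Fin (2 ^ n) → Bits n
  bitsOf j = bit p (d j)

  d≡⟦bitsOf⟧ : ∀ j → d j ≡ ⟦ bitsOf j ⟧
  d≡⟦bitsOf⟧ j = sym (⟦bit⟧ (d j) (d∣N j))

  d-pos : ∀ j → 0 ℕ.< d j
  d-pos j = subst (0 ℕ.<_) (sym (d≡⟦bitsOf⟧ j)) (⟦⟧-pos (bitsOf j))

  d-injective : ∀ i j → d i ≡ d j → i ≡ j
  d-injective i j dᵢ≡dⱼ with FinP.<-cmp i j
  ... | tri< i<j _ _ = ⊥-elim (≺-irrefl p (d j) (subst (_≺⟨ p ⟩ d j) dᵢ≡dⱼ (d-mono i j i<j)))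
  ... | tri≈ _ i≡j _ = i≡j
  ... | tri> _ _ j<i = ⊥-elim (≺-irrefl p (d j) (subst (d j ≺⟨ p ⟩_) dᵢ≡dⱼ (d-mono j i j<i)))

  d-reflects-≺ : ∀ k l → d k ≺⟨ p ⟩ d l → k < l
  d-reflects-≺ k l dₖ≺dₗ with FinP.<-cmp k l
  ... | tri< k<l _ _ = k<l
  ... | tri≈ _ refl _ = ⊥-elim (≺-irrefl p (d k) dₖ≺dₗ)
  ... | tri> _ _ l<k = ⊥-elim (≺-asym p dₖ≺dₗ (d-mono l k l<k))

  d-opposite : ∀ j → d (opposite j) ≡ ndiv N (d j)
  d-opposite j = trans (cong d (sym (decreasing⇒opposite cofactor cofactor↓ j))) (d-cofactor j)
    where
    N/d∣N : ∀ j → ndiv N (d j) ∣ N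
    N/d∣N j = subst (_∣ N) (sym (trans (cong (ndiv N) (d≡⟦bitsOf⟧ j)) (N/⟦⟧ (bitsOf j)))) (⟦⟧∣N _)
    cofactor : Fin (2 ^ n) → Fin (2 ^ n)
    cofactor j = proj₁ (d-onto (ndiv N (d j)) (N/d∣N j))
    d-cofactor : ∀ j → d (cofactor j) ≡ ndiv N (d j)
    d-cofactor j = proj₂ (d-onto (ndiv N (d j)) (N/d∣N j))
    cofactor↓ : ∀ i j → i < j → cofactor j < cofactor i
    cofactor↓ i j i<j = d-reflects-≺ _ _ (subst₂ _≺⟨ p ⟩_ (sym (d-cofactor j)) (sym (d-cofactor i))
                          (≺-N/ p p-prime p-injective (d∣N i) (d∣N j) (d-mono i j i<j)))

  indexOf : Bits n → Fin (2 ^ n)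
  indexOf c = proj₁ (d-onto ⟦ c ⟧ (⟦⟧∣N c))

  d-indexOf : ∀ c → d (indexOf c) ≡ ⟦ c ⟧
  d-indexOf c = proj₂ (d-onto ⟦ c ⟧ (⟦⟧∣N c))

  bitsOf-indexOf : ∀ c i → bitsOf (indexOf c) i ≡ c i
  bitsOf-indexOf c i = trans (cong (λ x → bit p x i) (d-indexOf c)) (bit-⟦⟧ c i)

  indexOf-bitsOf : ∀ j → indexOf (bitsOf j) ≡ j
  indexOf-bitsOf j = d-injective _ _ (trans (d-indexOf (bitsOf j)) (sym (d≡⟦bitsOf⟧ j)))

  indexOf-cong : ∀ {b c} → (∀ i → b i ≡ c i) → indexOf b ≡ indexOf c
  indexOf-cong {b} {c} b≗c = d-injective _ _ (trans (d-indexOf b) (trans (fromBits-cong p b≗c) (sym (d-indexOf c))))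

  d-first : ∀ j → toℕ j ≡ 0 → d j ≡ 1
  d-first j j≡0 with d-onto 1 (divides N (sym (*-identityʳ N)))
  ... | k , dₖ≡1 with FinP.<-cmp j k
  ...   | tri< j<k _ _ = ⊥-elim (¬≺1 p p-prime p-injective (d∣N j) (subst (d j ≺⟨ p ⟩_) dₖ≡1 (d-mono j k j<k)))
  ...   | tri≈ _ refl _ = dₖ≡1
  ...   | tri> _ _ k<j = ⊥-elim (n≮0 (subst (toℕ k ℕ.<_) j≡0 k<j))

module RationalSums where

  open import Data.Nat as ℕ using (zero; suc; _+_)
  open import Data.Fin using (zero; suc; _↑ˡ_; _↑ʳ_; splitAt; join; _≟_)
  open import Data.Fin.Properties using (splitAt-↑ˡ; splitAt-↑ʳ; join-splitAt)
  open import Data.Fin.Permutation using (permutation)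
  open import Data.Rational using (ℚ; 0ℚ; 1ℚ) renaming (_+_ to _+ℚ_; _*_ to _*ℚ_)
  import Data.Rational.Properties as ℚP
  open import Data.Bool using (true; false; if_then_else_)
  open import Data.Vec.Functional using (_∷_)
  open import Data.Sum using (inj₁; inj₂; [_,_]′)
  open import Data.Empty using (⊥-elim)
  open import Function using (_∘_)
  open import Relation.Nullary using (yes; no)
  open import Relation.Binary.PropositionalEquality
  open Squarefree using (Bits)

  open ≡-CommutativeMonoidSums ℚP.+-0-isCommutativeMonoid public
    using (sum-cong-≗; sum-single; ∑-comm; sum-permute) renaming (sum to ∑)
  module Πℚ = ≡-CommutativeMonoidSums ℚP.*-1-isCommutativeMonoid

  ∏ℚ : ∀ {n} → (Fin n → ℚ) → ℚ
  ∏ℚ = Πℚ.sum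

  sumQ≡∑ : ∀ {k} (f : Fin k → ℚ) → sumQ f ≡ ∑ f
  sumQ≡∑ {zero}  f = refl
  sumQ≡∑ {suc k} f = cong (f zero +ℚ_) (sumQ≡∑ (f ∘ suc))

  ∑-distribˡ : ∀ {k} c (f : Fin k → ℚ) → c *ℚ ∑ f ≡ ∑ (λ i → c *ℚ f i)
  ∑-distribˡ {zero}  c f = ℚP.*-zeroʳ c
  ∑-distribˡ {suc k} c f =
    trans (ℚP.*-distribˡ-+ c (f zero) (∑ (f ∘ suc))) (cong (c *ℚ f zero +ℚ_) (∑-distribˡ c (f ∘ suc)))

  ∑-distribʳ : ∀ {k} c (f : Fin k → ℚ) → ∑ f *ℚ c ≡ ∑ (λ i → f i *ℚ c)
  ∑-distribʳ c f = trans (ℚP.*-comm (∑ f) c) (trans (∑-distribˡ c f) (sum-cong-≗ (λ i → ℚP.*-comm c (f i))))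

  ⊗≡∑ : ∀ {m k l} (A : Matrix m k) (B : Matrix k l) i j → (A ⊗ B) i j ≡ ∑ (λ t → A i t *ℚ B t j)
  ⊗≡∑ A B i j = sumQ≡∑ (λ t → A i t *ℚ B t j)

  ⊗-assoc : ∀ {m k l r} (A : Matrix m k) (B : Matrix k l) (C : Matrix l r) i j →
            (A ⊗ (B ⊗ C)) i j ≡ ((A ⊗ B) ⊗ C) i j
  ⊗-assoc A B C i j = begin
      (A ⊗ (B ⊗ C)) i j
    ≡⟨ trans (⊗≡∑ A (B ⊗ C) i j) (sum-cong-≗ (λ t → cong (A i t *ℚ_) (⊗≡∑ B C t j))) ⟩
      ∑ (λ t → A i t *ℚ ∑ (λ u → B t u *ℚ C u j))
    ≡⟨ sum-cong-≗ (λ t → trans (∑-distribˡ (A i t) (λ u → B t u *ℚ C u j))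
                                (sum-cong-≗ (λ u → sym (ℚP.*-assoc (A i t) (B t u) (C u j))))) ⟩
      ∑ (λ t → ∑ (λ u → A i t *ℚ B t u *ℚ C u j))
    ≡⟨ ∑-comm (λ t u → A i t *ℚ B t u *ℚ C u j) ⟩
      ∑ (λ u → ∑ (λ t → A i t *ℚ B t u *ℚ C u j))
    ≡⟨ sum-cong-≗ (λ u → sym (trans (cong (_*ℚ C u j) (⊗≡∑ A B i u))
                                    (∑-distribʳ (C u j) (λ t → A i t *ℚ B t u)))) ⟩
      ∑ (λ u → (A ⊗ B) i u *ℚ C u j)
    ≡⟨ sym (⊗≡∑ (A ⊗ B) C i j) ⟩
      ((A ⊗ B) ⊗ C) i j ∎
    where open ≡-Reasoning

  identity-⊗ : ∀ {m k} (A : Matrix m k) i j → (identity ⊗ A) i j ≡ A i j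
  identity-⊗ A i j =
    trans (⊗≡∑ identity A i j) (trans (sum-single (λ t → identity i t *ℚ A t j) i off-diagonal) (diagonal i))
    where
    diagonal : ∀ i → identity i i *ℚ A i j ≡ A i j
    diagonal i with i ≟ i
    ... | yes _  = ℚP.*-identityˡ (A i j)
    ... | no i≢i = ⊥-elim (i≢i refl)
    off-diagonal : ∀ t → t ≢ i → identity i t *ℚ A t j ≡ 0ℚ
    off-diagonal t t≢i with i ≟ t
    ... | yes i≡t = ⊥-elim (t≢i (sym i≡t))
    ... | no _    = ℚP.*-zeroˡ (A t j)

  ⊗-congʳ : ∀ {m k l} (A : Matrix m k) {B C : Matrix k l} → (∀ i j → B i j ≡ C i j) →
            ∀ i j → (A ⊗ B) i j ≡ (A ⊗ C) i j
  ⊗-congʳ A {B} {C} B≗C i j =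
    trans (⊗≡∑ A B i j) (trans (sum-cong-≗ (λ t → cong (A i t *ℚ_) (B≗C t j))) (sym (⊗≡∑ A C i j)))

  ⊗-congˡ : ∀ {m k l} {A B : Matrix m k} (C : Matrix k l) → (∀ i j → A i j ≡ B i j) →
            ∀ i j → (A ⊗ C) i j ≡ (B ⊗ C) i j
  ⊗-congˡ {A = A} {B} C A≗B i j =
    trans (⊗≡∑ A C i j) (trans (sum-cong-≗ (λ t → cong (_*ℚ C t j) (A≗B i t))) (sym (⊗≡∑ B C i j)))

  left-inverse-solves : ∀ {m k} (L A : Matrix m m) (X B : Matrix m k) →
    (∀ i j → (L ⊗ A) i j ≡ identity i j) → (∀ i j → (A ⊗ X) i j ≡ B i j) →
    ∀ i j → (L ⊗ B) i j ≡ X i j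
  left-inverse-solves L A X B LA≡I AX≡B i j = begin
    (L ⊗ B) i j        ≡⟨ ⊗-congʳ L (λ i j → sym (AX≡B i j)) i j ⟩
    (L ⊗ (A ⊗ X)) i j  ≡⟨ ⊗-assoc L A X i j ⟩
    ((L ⊗ A) ⊗ X) i j  ≡⟨ ⊗-congˡ X LA≡I i j ⟩
    (identity ⊗ X) i j ≡⟨ identity-⊗ X i j ⟩
    X i j              ∎
    where open ≡-Reasoning

  ∑ᵇ : ∀ {n} → (Bits n → ℚ) → ℚ
  ∑ᵇ {zero}  F = F (λ ())
  ∑ᵇ {suc n} F = ∑ᵇ (F ∘ (false ∷_)) +ℚ ∑ᵇ (F ∘ (true ∷_))

  ∑ᵇ-cong : ∀ {n} {F G : Bits n → ℚ} → (∀ b → F b ≡ G b) → ∑ᵇ F ≡ ∑ᵇ G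
  ∑ᵇ-cong {zero}  F≗G = F≗G _
  ∑ᵇ-cong {suc n} F≗G = cong₂ _+ℚ_ (∑ᵇ-cong (F≗G ∘ (false ∷_))) (∑ᵇ-cong (F≗G ∘ (true ∷_)))

  ∑ᵇ-distribˡ : ∀ {n} c (F : Bits n → ℚ) → c *ℚ ∑ᵇ F ≡ ∑ᵇ (λ b → c *ℚ F b)
  ∑ᵇ-distribˡ {zero}  c F = refl
  ∑ᵇ-distribˡ {suc n} c F = trans (ℚP.*-distribˡ-+ c (∑ᵇ (F ∘ (false ∷_))) (∑ᵇ (F ∘ (true ∷_))))
                                  (cong₂ _+ℚ_ (∑ᵇ-distribˡ c (F ∘ (false ∷_))) (∑ᵇ-distribˡ c (F ∘ (true ∷_))))

  ∑ᵇ-∏ : ∀ {n} (h : Fin n → Bool → ℚ) →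
         ∑ᵇ (λ b → ∏ℚ (λ i → h i (b i))) ≡ ∏ℚ (λ i → h i false +ℚ h i true)
  ∑ᵇ-∏ {zero}  h = refl
  ∑ᵇ-∏ {suc n} h = begin
      ∑ᵇ (λ b → h zero false *ℚ P b) +ℚ ∑ᵇ (λ b → h zero true *ℚ P b)
    ≡⟨ sym (cong₂ _+ℚ_ (∑ᵇ-distribˡ (h zero false) P) (∑ᵇ-distribˡ (h zero true) P)) ⟩
      h zero false *ℚ ∑ᵇ P +ℚ h zero true *ℚ ∑ᵇ P
    ≡⟨ sym (ℚP.*-distribʳ-+ (∑ᵇ P) (h zero false) (h zero true)) ⟩
      (h zero false +ℚ h zero true) *ℚ ∑ᵇ P
    ≡⟨ cong ((h zero false +ℚ h zero true) *ℚ_) (∑ᵇ-∏ (h ∘ suc)) ⟩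
      (h zero false +ℚ h zero true) *ℚ ∏ℚ (λ i → h (suc i) false +ℚ h (suc i) true) ∎
    where
    open ≡-Reasoning
    P : Bits n → ℚ
    P b = ∏ℚ (λ i → h (suc i) (b i))

  -- This is 2ⁿ, built by doubling so that splitAt separates the vectors starting with false and true.
  #Bits : ℕ → ℕ
  #Bits zero    = 1
  #Bits (suc n) = #Bits n + #Bits n

  bitsAt : ∀ n → Fin (#Bits n) → Bits n
  bitsAt zero    k = λ ()
  bitsAt (suc n) k = [ (λ j → false ∷ bitsAt n j) , (λ j → true ∷ bitsAt n j) ]′ (splitAt (#Bits n) k)

  positionOf : ∀ n → Bits n → Fin (#Bits n)
  positionOf zero    b = zero
  positionOf (suc n) b =
    if b zero then #Bits n ↑ʳ positionOf n (b ∘ suc) else positionOf n (b ∘ suc) ↑ˡ #Bits n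

  positionOf-cong : ∀ n {b c : Bits n} → (∀ i → b i ≡ c i) → positionOf n b ≡ positionOf n c
  positionOf-cong zero    b≗c = refl
  positionOf-cong (suc n) {b} {c} b≗c
    rewrite b≗c zero | positionOf-cong n {b ∘ suc} {c ∘ suc} (b≗c ∘ suc) = refl

  bitsAt-positionOf : ∀ n (b : Bits n) i → bitsAt n (positionOf n b) i ≡ b i
  bitsAt-positionOf (suc n) b i with b zero in b₀
  ... | true rewrite splitAt-↑ʳ (#Bits n) (#Bits n) (positionOf n (b ∘ suc)) = tail i
    where
    tail : ∀ i → (true ∷ bitsAt n (positionOf n (b ∘ suc))) i ≡ b i
    tail zero    = sym b₀
    tail (suc i) = bitsAt-positionOf n (b ∘ suc) i
  ... | false rewrite splitAt-↑ˡ (#Bits n) (positionOf n (b ∘ suc)) (#Bits n) = tail i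
    where
    tail : ∀ i → (false ∷ bitsAt n (positionOf n (b ∘ suc))) i ≡ b i
    tail zero    = sym b₀
    tail (suc i) = bitsAt-positionOf n (b ∘ suc) i

  positionOf-bitsAt : ∀ n k → positionOf n (bitsAt n k) ≡ k
  positionOf-bitsAt zero    zero = refl
  positionOf-bitsAt (suc n) k with splitAt (#Bits n) k in eq
  ... | inj₁ j = trans (cong (_↑ˡ #Bits n) (positionOf-bitsAt n j))
                       (trans (cong (join (#Bits n) (#Bits n)) (sym eq)) (join-splitAt (#Bits n) (#Bits n) k))
  ... | inj₂ j = trans (cong (#Bits n ↑ʳ_) (positionOf-bitsAt n j))
                       (trans (cong (join (#Bits n) (#Bits n)) (sym eq)) (join-splitAt (#Bits n) (#Bits n) k))

  ∑-split : ∀ m k (f : Fin (m + k) → ℚ) → ∑ f ≡ ∑ (λ i → f (i ↑ˡ k)) +ℚ ∑ (λ i → f (m ↑ʳ i))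
  ∑-split zero    k f = sym (ℚP.+-identityˡ (∑ f))
  ∑-split (suc m) k f = trans (cong (f zero +ℚ_) (∑-split m k (f ∘ suc)))
                              (sym (ℚP.+-assoc (f zero) (∑ (λ i → f (suc i ↑ˡ k))) (∑ (λ i → f (suc m ↑ʳ i)))))

  ∑ᵇ≡∑-bitsAt : ∀ n (F : Bits n → ℚ) → ∑ᵇ F ≡ ∑ (F ∘ bitsAt n)
  ∑ᵇ≡∑-bitsAt zero    F = sym (ℚP.+-identityʳ (F (λ ())))
  ∑ᵇ≡∑-bitsAt (suc n) F = sym (trans (∑-split (#Bits n) (#Bits n) (F ∘ bitsAt (suc n)))
    (cong₂ _+ℚ_ (trans (sum-cong-≗ (λ i → cong (F ∘ pick) (splitAt-↑ˡ (#Bits n) i (#Bits n))))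
                       (sym (∑ᵇ≡∑-bitsAt n (F ∘ (false ∷_)))))
                (trans (sum-cong-≗ (λ i → cong (F ∘ pick) (splitAt-↑ʳ (#Bits n) (#Bits n) i)))
                       (sym (∑ᵇ≡∑-bitsAt n (F ∘ (true ∷_)))))))
    where
    pick = [ (λ j → false ∷ bitsAt n j) , (λ j → true ∷ bitsAt n j) ]′

  ∑-reindex : ∀ {s n} (β : Fin s → Bits n) (β⁻ : Bits n → Fin s) (F : Bits n → ℚ) →
    (∀ {b c} → (∀ i → b i ≡ c i) → F b ≡ F c) →
    (∀ {b c} → (∀ i → b i ≡ c i) → β⁻ b ≡ β⁻ c) →
    (∀ b i → β (β⁻ b) i ≡ b i) → (∀ j → β⁻ (β j) ≡ j) →
    ∑ (F ∘ β) ≡ ∑ᵇ F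
  ∑-reindex {s} {n} β β⁻ F F-cong β⁻-cong ββ⁻ β⁻β = sym (begin
      ∑ᵇ F                                         ≡⟨ ∑ᵇ≡∑-bitsAt n F ⟩
      ∑ (F ∘ bitsAt n)                             ≡⟨ sum-permute (F ∘ bitsAt n) π ⟩
      ∑ (λ j → F (bitsAt n (positionOf n (β j))))  ≡⟨ sum-cong-≗ (λ j → F-cong (bitsAt-positionOf n (β j))) ⟩
      ∑ (F ∘ β)                                    ∎)
    where
    open ≡-Reasoning
    π = permutation (positionOf n ∘ β) (β⁻ ∘ bitsAt n)
          (λ k → trans (positionOf-cong n (ββ⁻ (bitsAt n k))) (positionOf-bitsAt n k))
          (λ j → trans (β⁻-cong (bitsAt-positionOf n (β j))) (β⁻β j))

  ∏ℚ-cong : ∀ {n} {f g : Fin n → ℚ} → (∀ i → f i ≡ g i) → ∏ℚ f ≡ ∏ℚ g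
  ∏ℚ-cong = Πℚ.sum-cong-≗

  ∏ℚ-* : ∀ {n} (f g : Fin n → ℚ) → ∏ℚ f *ℚ ∏ℚ g ≡ ∏ℚ (λ i → f i *ℚ g i)
  ∏ℚ-* f g = sym (Πℚ.∑-distrib-+ f g)

  ∏ℚ-1 : ∀ {n} (f : Fin n → ℚ) → (∀ i → f i ≡ 1ℚ) → ∏ℚ f ≡ 1ℚ
  ∏ℚ-1 = Πℚ.sum-ε

  ∏ℚ-0 : ∀ {n} (f : Fin n → ℚ) i → f i ≡ 0ℚ → ∏ℚ f ≡ 0ℚ
  ∏ℚ-0 f zero    f₀≡0 = trans (cong (_*ℚ ∏ℚ (f ∘ suc)) f₀≡0) (ℚP.*-zeroˡ (∏ℚ (f ∘ suc)))
  ∏ℚ-0 f (suc i) fᵢ≡0 = trans (cong (f zero *ℚ_) (∏ℚ-0 (f ∘ suc) i fᵢ≡0)) (ℚP.*-zeroʳ (f zero))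

module Embedding where

  open import Data.Nat as ℕ using (zero; suc; _+_; _*_; _∸_; _<_; z≤n; s≤s)
  import Data.Nat.Properties as ℕP
  open import Data.Integer as ℤ using (+_)
  import Data.Integer.Properties as ℤP
  open import Data.Rational using (ℚ; 0ℚ; 1ℚ; -_; toℚᵘ) renaming (_+_ to _+ℚ_; _*_ to _*ℚ_)
  open import Data.Rational.Properties using (toℚᵘ-injective; toℚᵘ-fromℚᵘ; toℚᵘ-homo-*; toℚᵘ-homo-+)
  import Data.Rational.Properties as ℚP
  open import Data.Rational.Unnormalised as ℚᵘ using (mkℚᵘ; *≡*) renaming (_≃_ to _≃ᵘ_)
  import Data.Rational.Unnormalised.Properties as ℚᵘP
  open import Data.Bool using (true; false; if_then_else_)
  open import Function using (_∘_)
  open import Relation.Binary.PropositionalEquality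
  open Squarefree using (∏; ∏-pos; _^ᵇ_; fromBits)
  open RationalSums using (∏ℚ; ∏ℚ-cong; ∏ℚ-*; ∏ℚ-1)

  toℚ : ℕ → ℚ
  toℚ x = divQ x 1

  toℚᵘ-divQ : ∀ x y → toℚᵘ (divQ x (suc y)) ≃ᵘ mkℚᵘ (+ x) y
  toℚᵘ-divQ x y = toℚᵘ-fromℚᵘ (mkℚᵘ (+ x) y)

  divQ-*-toℚ : ∀ x y → 0 < y → divQ x y *ℚ toℚ y ≡ toℚ x
  divQ-*-toℚ x (suc y) _ = toℚᵘ-injective (begin
      toℚᵘ (divQ x (suc y) *ℚ toℚ (suc y))        ≈⟨ toℚᵘ-homo-* (divQ x (suc y)) (toℚ (suc y)) ⟩
      toℚᵘ (divQ x (suc y)) ℚᵘ.* toℚᵘ (toℚ (suc y)) ≈⟨ ℚᵘP.*-cong (toℚᵘ-divQ x y) (toℚᵘ-divQ (suc y) 0) ⟩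
      mkℚᵘ (+ x) y ℚᵘ.* mkℚᵘ (+ suc y) 0           ≈⟨ *≡* cross ⟩
      mkℚᵘ (+ x) 0                                 ≈⟨ ℚᵘP.≃-sym (toℚᵘ-divQ x 0) ⟩
      toℚᵘ (toℚ x)                                 ∎)
    where
    open ℚᵘP.≃-Reasoning
    cross : (+ x ℤ.* + suc y) ℤ.* + 1 ≡ + x ℤ.* + (suc y ℕ.* 1)
    cross = trans (ℤP.*-identityʳ _) (cong (λ z → + x ℤ.* + z) (sym (ℕP.*-identityʳ (suc y))))

  toℚ-* : ∀ x y → toℚ (x * y) ≡ toℚ x *ℚ toℚ y
  toℚ-* x y = toℚᵘ-injective (begin
      toℚᵘ (toℚ (x * y))                 ≈⟨ toℚᵘ-divQ (x * y) 0 ⟩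
      mkℚᵘ (+ (x * y)) 0                 ≈⟨ *≡* (cong (ℤ._* + 1) (ℤP.pos-* x y)) ⟩
      mkℚᵘ (+ x) 0 ℚᵘ.* mkℚᵘ (+ y) 0     ≈⟨ ℚᵘP.≃-sym (ℚᵘP.*-cong (toℚᵘ-divQ x 0) (toℚᵘ-divQ y 0)) ⟩
      toℚᵘ (toℚ x) ℚᵘ.* toℚᵘ (toℚ y)     ≈⟨ ℚᵘP.≃-sym (toℚᵘ-homo-* (toℚ x) (toℚ y)) ⟩
      toℚᵘ (toℚ x *ℚ toℚ y)              ∎)
    where open ℚᵘP.≃-Reasoning

  toℚ-+ : ∀ x y → toℚ (x + y) ≡ toℚ x +ℚ toℚ y
  toℚ-+ x y = toℚᵘ-injective (begin
      toℚᵘ (toℚ (x + y))                 ≈⟨ toℚᵘ-divQ (x + y) 0 ⟩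
      mkℚᵘ (+ (x + y)) 0                 ≈⟨ *≡* cross ⟩
      mkℚᵘ (+ x) 0 ℚᵘ.+ mkℚᵘ (+ y) 0     ≈⟨ ℚᵘP.≃-sym (ℚᵘP.+-cong (toℚᵘ-divQ x 0) (toℚᵘ-divQ y 0)) ⟩
      toℚᵘ (toℚ x) ℚᵘ.+ toℚᵘ (toℚ y)     ≈⟨ ℚᵘP.≃-sym (toℚᵘ-homo-+ (toℚ x) (toℚ y)) ⟩
      toℚᵘ (toℚ x +ℚ toℚ y)              ∎)
    where
    open ℚᵘP.≃-Reasoning
    cross : + (x + y) ℤ.* + 1 ≡ (+ x ℤ.* + 1 ℤ.+ + y ℤ.* + 1) ℤ.* + 1
    cross = cong (ℤ._* + 1) (trans (ℤP.pos-+ x y) (sym (cong₂ ℤ._+_ (ℤP.*-identityʳ (+ x)) (ℤP.*-identityʳ (+ y)))))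

  toℚ-pred : ∀ q → 0 < q → toℚ (q ∸ 1) ≡ toℚ q +ℚ - 1ℚ
  toℚ-pred (suc q) _ = sym (begin
      toℚ (suc q) +ℚ - 1ℚ        ≡⟨ cong (_+ℚ - 1ℚ) (trans (cong toℚ (ℕP.+-comm 1 q)) (toℚ-+ q 1)) ⟩
      toℚ q +ℚ 1ℚ +ℚ - 1ℚ        ≡⟨ ℚP.+-assoc (toℚ q) 1ℚ (- 1ℚ) ⟩
      toℚ q +ℚ (1ℚ +ℚ - 1ℚ)      ≡⟨ cong (toℚ q +ℚ_) (ℚP.+-inverseʳ 1ℚ) ⟩
      toℚ q +ℚ 0ℚ                ≡⟨ ℚP.+-identityʳ (toℚ q) ⟩
      toℚ q                      ∎)
    where open ≡-Reasoning

  *toℚ-cancelʳ : ∀ y {a b} → 0 < y → a *ℚ toℚ y ≡ b *ℚ toℚ y → a ≡ b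
  *toℚ-cancelʳ y {a} {b} y>0 ay≡by = begin
      a                                 ≡⟨ sym (unit a) ⟩
      a *ℚ toℚ y *ℚ divQ 1 y            ≡⟨ cong (_*ℚ divQ 1 y) ay≡by ⟩
      b *ℚ toℚ y *ℚ divQ 1 y            ≡⟨ unit b ⟩
      b                                 ∎
    where
    open ≡-Reasoning
    unit : ∀ c → c *ℚ toℚ y *ℚ divQ 1 y ≡ c
    unit c = trans (ℚP.*-assoc c (toℚ y) (divQ 1 y))
               (trans (cong (c *ℚ_) (trans (ℚP.*-comm (toℚ y) (divQ 1 y)) (divQ-*-toℚ 1 y y>0))) (ℚP.*-identityʳ c))

  divQ-self : ∀ x → 0 < x → divQ x x ≡ 1ℚ
  divQ-self x x>0 = *toℚ-cancelʳ x x>0 (trans (divQ-*-toℚ x x x>0) (sym (ℚP.*-identityˡ (toℚ x))))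

  divQ-cancelˡ : ∀ k z → 0 < k → 0 < z → divQ k (k * z) ≡ divQ 1 z
  divQ-cancelˡ k z k>0 z>0 = *toℚ-cancelʳ (k * z) (ℕP.*-mono-≤ k>0 z>0) (begin
      divQ k (k * z) *ℚ toℚ (k * z)           ≡⟨ divQ-*-toℚ k (k * z) (ℕP.*-mono-≤ k>0 z>0) ⟩
      toℚ k                                   ≡⟨ sym (ℚP.*-identityʳ (toℚ k)) ⟩
      toℚ k *ℚ 1ℚ                             ≡⟨ cong (toℚ k *ℚ_) (sym (divQ-*-toℚ 1 z z>0)) ⟩
      toℚ k *ℚ (divQ 1 z *ℚ toℚ z)            ≡⟨ sym (ℚP.*-assoc (toℚ k) (divQ 1 z) (toℚ z)) ⟩
      toℚ k *ℚ divQ 1 z *ℚ toℚ z              ≡⟨ cong (_*ℚ toℚ z) (ℚP.*-comm (toℚ k) (divQ 1 z)) ⟩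
      divQ 1 z *ℚ toℚ k *ℚ toℚ z              ≡⟨ ℚP.*-assoc (divQ 1 z) (toℚ k) (toℚ z) ⟩
      divQ 1 z *ℚ (toℚ k *ℚ toℚ z)            ≡⟨ cong (divQ 1 z *ℚ_) (sym (toℚ-* k z)) ⟩
      divQ 1 z *ℚ toℚ (k * z)                 ∎)
    where open ≡-Reasoning

  divQ-*-cancelˡ : ∀ k z → 0 < k → divQ (k * z) k ≡ toℚ z
  divQ-*-cancelˡ k z k>0 = *toℚ-cancelʳ k k>0
    (trans (divQ-*-toℚ (k * z) k k>0) (trans (toℚ-* k z) (ℚP.*-comm (toℚ k) (toℚ z))))

  _^ᵠ_ : ℚ → Bool → ℚ
  x ^ᵠ b = if b then x else 1ℚ

  toℚ-^ᵇ : ∀ q x → toℚ (q ^ᵇ x) ≡ toℚ q ^ᵠ x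
  toℚ-^ᵇ q true  = refl
  toℚ-^ᵇ q false = refl

  toℚ-∏ : ∀ {n} (f : Fin n → ℕ) → toℚ (∏ f) ≡ ∏ℚ (toℚ ∘ f)
  toℚ-∏ {zero}  f = refl
  toℚ-∏ {suc n} f =
    trans (toℚ-* (f Fin.zero) (∏ (f ∘ Fin.suc))) (cong (toℚ (f Fin.zero) *ℚ_) (toℚ-∏ (f ∘ Fin.suc)))

  toℚ-fromBits : ∀ {n} (p : Fin n → ℕ) b → toℚ (fromBits p b) ≡ ∏ℚ (λ i → toℚ (p i) ^ᵠ b i)
  toℚ-fromBits p b = trans (toℚ-∏ (λ i → p i ^ᵇ b i)) (∏ℚ-cong (λ i → toℚ-^ᵇ (p i) (b i)))

  divQ-1-fromBits : ∀ {n} (p : Fin n → ℕ) → (∀ i → 0 < p i) → ∀ b →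
    divQ 1 (fromBits p b) ≡ ∏ℚ (λ i → divQ 1 (p i) ^ᵠ b i)
  divQ-1-fromBits p p>0 b = *toℚ-cancelʳ (fromBits p b) (∏-pos _ (λ i → pos (b i) i)) (begin
      divQ 1 (fromBits p b) *ℚ toℚ (fromBits p b)      ≡⟨ divQ-*-toℚ 1 _ (∏-pos _ (λ i → pos (b i) i)) ⟩
      1ℚ                                               ≡⟨ sym (∏ℚ-1 _ (λ i → inverse (b i) i)) ⟩
      ∏ℚ (λ i → divQ 1 (p i) ^ᵠ b i *ℚ toℚ (p i) ^ᵠ b i) ≡⟨ sym (∏ℚ-* P⁻¹ P) ⟩
      ∏ℚ P⁻¹ *ℚ ∏ℚ P                                   ≡⟨ cong (∏ℚ P⁻¹ *ℚ_) (sym (toℚ-fromBits p b)) ⟩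
      ∏ℚ P⁻¹ *ℚ toℚ (fromBits p b)                     ∎)
    where
    open ≡-Reasoning
    P⁻¹ P : Fin _ → ℚ
    P⁻¹ i = divQ 1 (p i) ^ᵠ b i
    P   i = toℚ (p i) ^ᵠ b i
    pos : ∀ x i → 0 < p i ^ᵇ x
    pos true  i = p>0 i
    pos false i = s≤s z≤n
    inverse : ∀ x i → divQ 1 (p i) ^ᵠ x *ℚ toℚ (p i) ^ᵠ x ≡ 1ℚ
    inverse true  i = divQ-*-toℚ 1 (p i) (p>0 i)
    inverse false i = refl

module Coordinate where

  open import Data.Nat as ℕ using (_+_; _∸_; _<_)
  open import Data.Rational using (ℚ; 0ℚ; 1ℚ; -_) renaming (_+_ to _+ℚ_; _*_ to _*ℚ_)
  open import Data.Rational.Solver using (module +-*-Solver)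
  open import Data.Rational.Properties using (neg-distribˡ-*; *-identityˡ)
  open import Data.Bool using (true; false; not; _∧_; _xor_; if_then_else_)
  open import Function using (_∘_)
  open import Relation.Binary.PropositionalEquality
  open Squarefree using (_^ᵇ_; count)
  open Embedding
  open RationalSums using (∏ℚ)
  open +-*-Solver

  sg : Bool → ℚ
  sg true  = - 1ℚ
  sg false = 1ℚ

  -- The contribution of the prime q to (d,c)²/(dc), to sgn(N/c) and to (N/c)/((N/c),M), where
  -- a, x, m are the q-bits of d, c, M.
  factor : (a m : Bool) (q : ℕ) (x : Bool) → ℚ
  factor a m q x = divQ 1 q ^ᵠ (a xor x) *ℚ (sg x *ℚ toℚ q ^ᵠ (not x ∧ not m))

  rowFactor : Bool → ℕ → ℚ
  rowFactor m q = divQ 1 q *ℚ toℚ (q ∸ 1) *ℚ toℚ ((q + 1) ^ᵇ not m)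

  -- The solver cannot use divQ 1 q *ℚ toℚ q ≡ 1ℚ, so each identity below is proved in the form
  -- lhs ≡ rhs + (divQ 1 q *ℚ toℚ q - 1) * z.
  x+[u-1]*z≡x : ∀ x z u → u ≡ 1ℚ → x +ℚ (u +ℚ - 1ℚ) *ℚ z ≡ x
  x+[u-1]*z≡x x z u refl = solve 2 (λ x z → x :+ (con 1ℚ :+ :- con 1ℚ) :* z := x) refl x z

  factor-sum-⊆ : ∀ a m q → 0 < q → (a ≡ true → m ≡ true) →
                 factor a m q false +ℚ factor a m q true ≡ sg a *ℚ rowFactor m q
  factor-sum-⊆ false false q q>0 _ rewrite toℚ-pred q q>0 | toℚ-+ q 1 =
    trans (solve 2 (λ r Q → con 1ℚ :* (con 1ℚ :* Q) :+ r :* (:- con 1ℚ :* con 1ℚ)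
                     := con 1ℚ :* (r :* (Q :+ :- con 1ℚ) :* (Q :+ con 1ℚ)) :+ (r :* Q :+ :- con 1ℚ) :* (:- Q))
                   refl (divQ 1 q) (toℚ q))
          (x+[u-1]*z≡x _ (- toℚ q) _ (divQ-*-toℚ 1 q q>0))
  factor-sum-⊆ false true q q>0 _ rewrite toℚ-pred q q>0 =
    trans (solve 2 (λ r Q → con 1ℚ :* (con 1ℚ :* con 1ℚ) :+ r :* (:- con 1ℚ :* con 1ℚ)
                     := con 1ℚ :* (r :* (Q :+ :- con 1ℚ) :* con 1ℚ) :+ (r :* Q :+ :- con 1ℚ) :* (:- con 1ℚ))
                   refl (divQ 1 q) (toℚ q))
          (x+[u-1]*z≡x _ (- 1ℚ) _ (divQ-*-toℚ 1 q q>0))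
  factor-sum-⊆ true true q q>0 _ rewrite toℚ-pred q q>0 =
    trans (solve 2 (λ r Q → r :* (con 1ℚ :* con 1ℚ) :+ con 1ℚ :* (:- con 1ℚ :* con 1ℚ)
                     := :- con 1ℚ :* (r :* (Q :+ :- con 1ℚ) :* con 1ℚ) :+ (r :* Q :+ :- con 1ℚ) :* con 1ℚ)
                   refl (divQ 1 q) (toℚ q))
          (x+[u-1]*z≡x _ 1ℚ _ (divQ-*-toℚ 1 q q>0))
  factor-sum-⊆ true false q q>0 a⇒m with () ← a⇒m refl

  factor-sum-⊈ : ∀ q → 0 < q → factor true false q false +ℚ factor true false q true ≡ 0ℚ
  factor-sum-⊈ q q>0 =
    trans (solve 2 (λ r Q → r :* (con 1ℚ :* Q) :+ con 1ℚ :* (:- con 1ℚ :* con 1ℚ)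
                     := con 0ℚ :+ (r :* Q :+ :- con 1ℚ) :* con 1ℚ) refl (divQ 1 q) (toℚ q))
          (x+[u-1]*z≡x _ 1ℚ _ (divQ-*-toℚ 1 q q>0))

  rowFactor*q : ∀ m q → 0 < q → rowFactor m q *ℚ toℚ q ≡ toℚ (q ∸ 1) *ℚ toℚ ((q + 1) ^ᵇ not m)
  rowFactor*q m q q>0 =
    trans (solve 4 (λ r Q A B → r :* A :* B :* Q := A :* B :+ (r :* Q :+ :- con 1ℚ) :* (A :* B)) refl
                   (divQ 1 q) (toℚ q) (toℚ (q ∸ 1)) (toℚ ((q + 1) ^ᵇ not m)))
          (x+[u-1]*z≡x _ _ _ (divQ-*-toℚ 1 q q>0))

  negOnePow-+ : ∀ a b → negOnePow (a ℕ.+ b) ≡ negOnePow a *ℚ negOnePow b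
  negOnePow-+ ℕ.zero    b = sym (*-identityˡ (negOnePow b))
  negOnePow-+ (ℕ.suc a) b = trans (cong -_ (negOnePow-+ a b)) (neg-distribˡ-* (negOnePow a) (negOnePow b))

  negOnePow-count : ∀ {n} (c : Fin n → Bool) → negOnePow (count c) ≡ ∏ℚ (sg ∘ c)
  negOnePow-count {ℕ.zero}  c = refl
  negOnePow-count {ℕ.suc n} c =
    trans (negOnePow-+ (if c Fin.zero then 1 else 0) (count (c ∘ Fin.suc)))
          (cong₂ _*ℚ_ (sign (c Fin.zero)) (negOnePow-count (c ∘ Fin.suc)))
    where
    sign : ∀ x → negOnePow (if x then 1 else 0) ≡ sg x
    sign true  = refl
    sign false = refl

module RowSum {n} (p : Fin n → ℕ) (p-prime : ∀ i → Prime (p i))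
    (p-injective : ∀ i j → p i ≡ p j → i ≡ j) (α μ : Squarefree.Bits n) where

  open import Data.Nat as ℕ using (_+_; _*_; _∸_; _<_; z≤n; s≤s)
  import Data.Nat.Properties as ℕP
  open import Data.Nat.GCD using (gcd)
  open import Data.Nat.Primality using (prime⇒nonZero; prime⇒nonTrivial)
  open import Data.Rational using (ℚ; 0ℚ; 1ℚ) renaming (_+_ to _+ℚ_; _*_ to _*ℚ_)
  import Data.Rational.Properties as ℚP
  open import Data.Rational.Solver using (module +-*-Solver)
  open import Data.Bool using (true; false; not; _∧_; _∨_; _xor_)
  open import Data.Bool.Properties using (∧-inverseʳ)
  open import Function using (_∘_; const)
  open import Relation.Binary.PropositionalEquality
  open Squarefree
  open Distinct p p-prime p-injective
  open RationalSums
  open Embedding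
  open Coordinate
  open +-*-Solver using (solve; _:*_; _:=_)

  p>0 : ∀ i → 0 < p i
  p>0 i = ℕ.>-nonZero⁻¹ (p i) {{prime⇒nonZero (p-prime i)}}

  M : ℕ
  M = ⟦ μ ⟧

  φψ : ℕ
  φψ = φ N * ψ (ndiv N M)

  K : ℚ
  K = divQ 24 φψ

  -- Λ_{αc} E_c as a function of x = d_c, with the index reversal of E rewritten as d_{s+1-c} = N/d_c.
  summandAt : ℕ → ℚ
  summandAt x = divQ 1 24 *ℚ aN N ⟦ α ⟧ x *ℚ (sgn N y *ℚ K *ℚ divQ y (gcd y M))
    where y = ndiv N x

  summand : Bits n → ℚ
  summand c = summandAt ⟦ c ⟧

  factorAt : Fin n → Bool → ℚ
  factorAt i = factor (α i) (μ i) (p i)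

  scale : ℚ
  scale = divQ 1 24 *ℚ toℚ N *ℚ K

  summand-cong : ∀ {b c} → (∀ i → b i ≡ c i) → summand b ≡ summand c
  summand-cong b≗c = cong summandAt (fromBits-cong p b≗c)

  N-part : divQ N (gcd ⟦ α ⟧ (ndiv N ⟦ α ⟧)) ≡ toℚ N
  N-part = cong (divQ N) (begin
    gcd ⟦ α ⟧ (ndiv N ⟦ α ⟧)   ≡⟨ cong (gcd ⟦ α ⟧) (N/⟦⟧ α) ⟩
    gcd ⟦ α ⟧ ⟦ not ∘ α ⟧      ≡⟨ gcd-⟦⟧ α (not ∘ α) ⟩
    ⟦ (λ i → α i ∧ not (α i)) ⟧ ≡⟨ fromBits-cong p (∧-inverseʳ ∘ α) ⟩
    ⟦ const false ⟧            ≡⟨ fromBits-none p ⟩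
    1                          ∎)
    where open ≡-Reasoning

  gcd²-part : ∀ c → divQ (gcd ⟦ α ⟧ ⟦ c ⟧ ℕ.^ 2) (⟦ α ⟧ * ⟦ c ⟧)
                  ≡ ∏ℚ (λ i → divQ 1 (p i) ^ᵠ (α i xor c i))
  gcd²-part c = begin
      divQ (gcd ⟦ α ⟧ ⟦ c ⟧ ℕ.^ 2) (⟦ α ⟧ * ⟦ c ⟧)
    ≡⟨ cong₂ (λ g y → divQ (g ℕ.^ 2) y) (gcd-⟦⟧ α c) αc≡g²z ⟩
      divQ (g * (g * 1)) (g * (g * 1) * z)
    ≡⟨ divQ-cancelˡ (g * (g * 1)) z (ℕP.*-mono-≤ (⟦⟧-pos _) (ℕP.*-mono-≤ (⟦⟧-pos _) (s≤s z≤n)))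
                    (⟦⟧-pos _) ⟩
      divQ 1 z
    ≡⟨ divQ-1-fromBits p p>0 (λ i → α i xor c i) ⟩
      ∏ℚ (λ i → divQ 1 (p i) ^ᵠ (α i xor c i)) ∎
    where
    open ≡-Reasoning
    g = ⟦ (λ i → α i ∧ c i) ⟧
    z = ⟦ (λ i → α i xor c i) ⟧
    ∧-∨ : ∀ a b q → q ^ᵇ (a ∧ b) * q ^ᵇ (a ∨ b) ≡ q ^ᵇ a * q ^ᵇ b
    ∧-∨ true  true  q = refl
    ∧-∨ true  false q = ℕP.*-comm 1 q
    ∧-∨ false b     q = refl
    ∧-xor : ∀ a b q → q ^ᵇ (a ∧ b) * q ^ᵇ (a xor b) ≡ q ^ᵇ (a ∨ b)
    ∧-xor true  true  q = ℕP.*-identityʳ q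
    ∧-xor true  false q = ℕP.*-identityˡ q
    ∧-xor false b     q = ℕP.*-identityˡ (q ^ᵇ b)
    αc≡g²z : ⟦ α ⟧ * ⟦ c ⟧ ≡ g * (g * 1) * z
    αc≡g²z = begin
      ⟦ α ⟧ * ⟦ c ⟧                 ≡⟨ sym (fromBits-*-exchange p _ _ α c (λ i → ∧-∨ (α i) (c i) (p i))) ⟩
      g * ⟦ (λ i → α i ∨ c i) ⟧     ≡⟨ cong (g *_) (sym (fromBits-* p _ _ _ (λ i → ∧-xor (α i) (c i) (p i)))) ⟩
      g * (g * z)                   ≡⟨ sym (ℕP.*-assoc g g z) ⟩
      g * g * z                     ≡⟨ cong (λ h → g * h * z) (sym (ℕP.*-identityʳ g)) ⟩
      g * (g * 1) * z               ∎
      where open ≡-Reasoning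

  sign-part : ∀ c → sgn N (ndiv N ⟦ c ⟧) ≡ ∏ℚ (sg ∘ c)
  sign-part c = begin
    negOnePow (ω N ∸ ω (ndiv N ⟦ c ⟧))   ≡⟨ cong negOnePow (cong₂ _∸_ ωN≡n ω-N/c) ⟩
    negOnePow (n ∸ (n ∸ count c))        ≡⟨ cong negOnePow (ℕP.m∸[m∸n]≡n (count≤n c)) ⟩
    negOnePow (count c)                  ≡⟨ negOnePow-count c ⟩
    ∏ℚ (sg ∘ c)                          ∎
    where
    open ≡-Reasoning
    ωN≡n : ω N ≡ n
    ωN≡n = trans (cong ω N≡⟦all⟧) (trans (ω-⟦⟧ (const true)) (count-all n))
    ω-N/c : ω (ndiv N ⟦ c ⟧) ≡ n ∸ count c
    ω-N/c = trans (cong ω (N/⟦⟧ c)) (trans (ω-⟦⟧ (not ∘ c)) (count-not c))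

  M-part : ∀ c → divQ (ndiv N ⟦ c ⟧) (gcd (ndiv N ⟦ c ⟧) M)
               ≡ ∏ℚ (λ i → toℚ (p i) ^ᵠ (not (c i) ∧ not (μ i)))
  M-part c = begin
      divQ (ndiv N ⟦ c ⟧) (gcd (ndiv N ⟦ c ⟧) M)
    ≡⟨ cong₂ divQ (trans (N/⟦⟧ c) (sym split)) (trans (cong (λ y → gcd y M) (N/⟦⟧ c)) (gcd-⟦⟧ (not ∘ c) μ)) ⟩
      divQ (⟦ (λ i → not (c i) ∧ μ i) ⟧ * ⟦ (λ i → not (c i) ∧ not (μ i)) ⟧)
           ⟦ (λ i → not (c i) ∧ μ i) ⟧
    ≡⟨ divQ-*-cancelˡ _ _ (⟦⟧-pos _) ⟩
      toℚ ⟦ (λ i → not (c i) ∧ not (μ i)) ⟧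
    ≡⟨ toℚ-fromBits p _ ⟩
      ∏ℚ (λ i → toℚ (p i) ^ᵠ (not (c i) ∧ not (μ i))) ∎
    where
    open ≡-Reasoning
    split : ⟦ (λ i → not (c i) ∧ μ i) ⟧ * ⟦ (λ i → not (c i) ∧ not (μ i)) ⟧ ≡ ⟦ not ∘ c ⟧
    split = fromBits-* p _ _ _ (λ i → ^ᵇ-∧-∧not (not (c i)) (μ i) (p i))

  summand-factorises : ∀ c → summand c ≡ scale *ℚ ∏ℚ (λ i → factorAt i (c i))
  summand-factorises c = begin
      divQ 1 24 *ℚ (divQ N (gcd ⟦ α ⟧ (ndiv N ⟦ α ⟧)) *ℚ divQ (gcd ⟦ α ⟧ ⟦ c ⟧ ℕ.^ 2) (⟦ α ⟧ * ⟦ c ⟧))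
        *ℚ (sgn N y *ℚ K *ℚ divQ y (gcd y M))
    ≡⟨ cong₂ (λ u v → divQ 1 24 *ℚ u *ℚ v) (cong₂ _*ℚ_ N-part (gcd²-part c))
                                          (cong₂ (λ u v → u *ℚ K *ℚ v) (sign-part c) (M-part c)) ⟩
      divQ 1 24 *ℚ (toℚ N *ℚ W) *ℚ (S *ℚ K *ℚ T)
    ≡⟨ solve 6 (λ a b w s k t → a :* (b :* w) :* (s :* k :* t) := a :* b :* k :* (w :* (s :* t)))
             refl (divQ 1 24) (toℚ N) W S K T ⟩
      scale *ℚ (W *ℚ (S *ℚ T))
    ≡⟨ cong (scale *ℚ_) (trans (cong (W *ℚ_) (∏ℚ-* (sg ∘ c) T′)) (∏ℚ-* W′ (λ i → sg (c i) *ℚ T′ i))) ⟩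
      scale *ℚ ∏ℚ (λ i → factorAt i (c i)) ∎
    where
    open ≡-Reasoning
    y = ndiv N ⟦ c ⟧
    W′ T′ : Fin n → ℚ
    W′ i = divQ 1 (p i) ^ᵠ (α i xor c i)
    T′ i = toℚ (p i) ^ᵠ (not (c i) ∧ not (μ i))
    W = ∏ℚ W′
    S = ∏ℚ (sg ∘ c)
    T = ∏ℚ T′

  ∑ᵇ-summand : ∑ᵇ summand ≡ scale *ℚ ∏ℚ (λ i → factorAt i false +ℚ factorAt i true)
  ∑ᵇ-summand = begin
    ∑ᵇ summand                                         ≡⟨ ∑ᵇ-cong summand-factorises ⟩
    ∑ᵇ (λ c → scale *ℚ ∏ℚ (λ i → factorAt i (c i)))    ≡⟨ sym (∑ᵇ-distribˡ {n} scale _) ⟩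
    scale *ℚ ∑ᵇ (λ c → ∏ℚ (λ i → factorAt i (c i)))    ≡⟨ cong (scale *ℚ_) (∑ᵇ-∏ factorAt) ⟩
    scale *ℚ ∏ℚ (λ i → factorAt i false +ℚ factorAt i true)  ∎
    where open ≡-Reasoning

  ψ-N/M : ψ (ndiv N M) ≡ ∏ (λ i → (p i + 1) ^ᵇ not (μ i))
  ψ-N/M = trans (cong ψ (N/⟦⟧ μ)) (ψ-⟦⟧ (not ∘ μ))

  φψ>0 : 0 < φψ
  φψ>0 = subst (0 <_) (sym (cong₂ _*_ φ-N ψ-N/M))
          (ℕP.*-mono-≤ (∏-pos _ (λ i → ℕP.m<n⇒0<n∸m (p>1 i))) (∏-pos _ (λ i → pos (not (μ i)) i)))
    where
    p>1 : ∀ i → 1 < p i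
    p>1 i = ℕ.nonTrivial⇒n>1 (p i) {{prime⇒nonTrivial (p-prime i)}}
    pos : ∀ x i → 0 < (p i + 1) ^ᵇ x
    pos true  i = ℕP.m≤n+m 1 (p i)
    pos false i = s≤s z≤n

  N*∏rowFactor≡φψ : toℚ N *ℚ ∏ℚ (λ i → rowFactor (μ i) (p i)) ≡ toℚ φψ
  N*∏rowFactor≡φψ = begin
      toℚ N *ℚ ∏ℚ (λ i → rowFactor (μ i) (p i))
    ≡⟨ cong (_*ℚ ∏ℚ (λ i → rowFactor (μ i) (p i))) (trans (cong toℚ N≡⟦all⟧) (toℚ-∏ p)) ⟩
      ∏ℚ (toℚ ∘ p) *ℚ ∏ℚ (λ i → rowFactor (μ i) (p i))
    ≡⟨ ∏ℚ-* (toℚ ∘ p) (λ i → rowFactor (μ i) (p i)) ⟩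
      ∏ℚ (λ i → toℚ (p i) *ℚ rowFactor (μ i) (p i))
    ≡⟨ ∏ℚ-cong (λ i → trans (ℚP.*-comm (toℚ (p i)) _) (rowFactor*q (μ i) (p i) (p>0 i))) ⟩
      ∏ℚ (λ i → toℚ (p i ∸ 1) *ℚ toℚ ((p i + 1) ^ᵇ not (μ i)))
    ≡⟨ sym (∏ℚ-* (λ i → toℚ (p i ∸ 1)) (λ i → toℚ ((p i + 1) ^ᵇ not (μ i)))) ⟩
      ∏ℚ (λ i → toℚ (p i ∸ 1)) *ℚ ∏ℚ (λ i → toℚ ((p i + 1) ^ᵇ not (μ i)))
    ≡⟨ sym (cong₂ _*ℚ_ (trans (cong toℚ φ-N) (toℚ-∏ (λ i → p i ∸ 1)))
                       (trans (cong toℚ ψ-N/M) (toℚ-∏ (λ i → (p i + 1) ^ᵇ not (μ i))))) ⟩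
      toℚ (φ N) *ℚ toℚ (ψ (ndiv N M))
    ≡⟨ sym (toℚ-* (φ N) (ψ (ndiv N M))) ⟩
      toℚ φψ ∎
    where open ≡-Reasoning

  scale*∏rowFactor≡1 : scale *ℚ ∏ℚ (λ i → rowFactor (μ i) (p i)) ≡ 1ℚ
  scale*∏rowFactor≡1 = begin
      divQ 1 24 *ℚ toℚ N *ℚ K *ℚ ∏rowFactor
    ≡⟨ solve 4 (λ a b k u → a :* b :* k :* u := a :* (k :* (b :* u))) refl (divQ 1 24) (toℚ N) K ∏rowFactor ⟩
      divQ 1 24 *ℚ (K *ℚ (toℚ N *ℚ ∏rowFactor))
    ≡⟨ cong (λ z → divQ 1 24 *ℚ (K *ℚ z)) N*∏rowFactor≡φψ ⟩
      divQ 1 24 *ℚ (K *ℚ toℚ φψ)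
    ≡⟨ cong (divQ 1 24 *ℚ_) (divQ-*-toℚ 24 φψ φψ>0) ⟩
      divQ 1 24 *ℚ toℚ 24
    ≡⟨ divQ-*-toℚ 1 24 (s≤s z≤n) ⟩
      1ℚ ∎
    where
    open ≡-Reasoning
    ∏rowFactor = ∏ℚ (λ i → rowFactor (μ i) (p i))

  row-sum-⊆ : α ⊆ᵇ μ → ∑ᵇ summand ≡ negOnePow (count α)
  row-sum-⊆ α⊆μ = begin
      ∑ᵇ summand
    ≡⟨ ∑ᵇ-summand ⟩
      scale *ℚ ∏ℚ (λ i → factorAt i false +ℚ factorAt i true)
    ≡⟨ cong (scale *ℚ_) (∏ℚ-cong (λ i → factor-sum-⊆ (α i) (μ i) (p i) (p>0 i) (α⊆μ i))) ⟩
      scale *ℚ ∏ℚ (λ i → sg (α i) *ℚ rowFactor (μ i) (p i))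
    ≡⟨ cong (scale *ℚ_) (sym (∏ℚ-* (sg ∘ α) (λ i → rowFactor (μ i) (p i)))) ⟩
      scale *ℚ (∏ℚ (sg ∘ α) *ℚ ∏rowFactor)
    ≡⟨ solve 3 (λ c s u → c :* (s :* u) := s :* (c :* u)) refl scale (∏ℚ (sg ∘ α)) ∏rowFactor ⟩
      ∏ℚ (sg ∘ α) *ℚ (scale *ℚ ∏rowFactor)
    ≡⟨ cong (∏ℚ (sg ∘ α) *ℚ_) scale*∏rowFactor≡1 ⟩
      ∏ℚ (sg ∘ α) *ℚ 1ℚ
    ≡⟨ ℚP.*-identityʳ _ ⟩
      ∏ℚ (sg ∘ α)
    ≡⟨ sym (negOnePow-count α) ⟩
      negOnePow (count α) ∎
    where
    open ≡-Reasoning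
    ∏rowFactor = ∏ℚ (λ i → rowFactor (μ i) (p i))

  row-sum-⊈ : ∀ i → α i ≡ true → μ i ≡ false → ∑ᵇ summand ≡ 0ℚ
  row-sum-⊈ i αᵢ μᵢ = trans ∑ᵇ-summand (trans (cong (scale *ℚ_) (∏ℚ-0 _ i vanishes)) (ℚP.*-zeroʳ scale))
    where
    vanishes : factor (α i) (μ i) (p i) false +ℚ factor (α i) (μ i) (p i) true ≡ 0ℚ
    vanishes rewrite αᵢ | μᵢ = factor-sum-⊈ (p i) (p>0 i)

module Solution {n} (p : Fin n → ℕ) (p-prime : ∀ i → Prime (p i))
    (p-injective : ∀ i j → p i ≡ p j → i ≡ j)
    (d : Fin (2 ^ n) → ℕ) (d∣N : ∀ i → d i ∣ prodFin p)
    (d-onto : ∀ a → a ∣ prodFin p → ∃ λ i → d i ≡ a)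
    (d-mono : ∀ i j → i Fin.< j → d i ≺⟨ p ⟩ d j)
    (M : ℕ) (M∣N : M ∣ prodFin p) where

  open import Data.Nat as ℕ using (_*_; _∸_)
  import Data.Nat.Properties as ℕP
  open import Data.Nat.GCD using (gcd; gcd-zeroˡ; gcd-greatest; gcd[m,n]∣m)
  open import Data.Nat.Divisibility using (_∣?_; ∣-antisym; ∣-refl)
  open import Data.Fin using (zero; toℕ; opposite)
  open import Data.Rational using (ℚ; 1ℚ) renaming (_*_ to _*ℚ_)
  import Data.Rational.Properties as ℚP
  open import Data.Product using (_,_)
  open import Data.Sum using (inj₁; inj₂)
  open import Data.Empty using (⊥-elim)
  open import Function using (_∘_)
  open import Relation.Nullary using (yes; no)
  open import Relation.Binary.PropositionalEquality
  open Squarefree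
  open Distinct p p-prime p-injective
  open DivisorIndexing p p-prime p-injective d d∣N d-onto d-mono
  open RationalSums
  open Embedding using (divQ-self)
  open FinOpposite using (opposite-last)

  μ : Bits n
  μ = bit p M

  ⟦μ⟧≡M : ⟦ μ ⟧ ≡ M
  ⟦μ⟧≡M = ⟦bit⟧ M M∣N

  E : Matrix (2 ^ n) 1
  E a _ = Eformula N M d a

  module Row (i : Fin (2 ^ n)) = RowSum p p-prime p-injective (bitsOf i) μ

  Λ*E≡summand : ∀ i j → Λ N d i j *ℚ E j zero ≡ Row.summand i (bitsOf j)
  Λ*E≡summand i j = trans (cong₂ (λ x y → entry x y (d (opposite j)) M) (d≡⟦bitsOf⟧ i) (d≡⟦bitsOf⟧ j))
                          (cong₂ (entry ⟦ bitsOf i ⟧ ⟦ bitsOf j ⟧)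
                                 (trans (d-opposite j) (cong (ndiv N) (d≡⟦bitsOf⟧ j))) (sym ⟦μ⟧≡M))
    where
    entry : ℕ → ℕ → ℕ → ℕ → ℚ
    entry x y o m = divQ 1 24 *ℚ aN N x y *ℚ (sgn N o *ℚ divQ 24 (φ N * ψ (ndiv N m)) *ℚ divQ o (gcd o m))

  row-sum≡C : ∀ i → ∑ᵇ (Row.summand i) ≡ Cvec M d i zero
  row-sum≡C i with d i ∣? M
  ... | yes dᵢ∣M = trans (Row.row-sum-⊆ i (∣⇒⊆ _ μ (subst₂ _∣_ (d≡⟦bitsOf⟧ i) (sym ⟦μ⟧≡M) dᵢ∣M)))
                         (cong negOnePow (sym (trans (cong ω (d≡⟦bitsOf⟧ i)) (ω-⟦⟧ (bitsOf i)))))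
  ... | no dᵢ∤M with ⊆ᵇ-or-witness (bitsOf i) μ
  ...   | inj₁ bitsᵢ⊆μ = ⊥-elim (dᵢ∤M (subst₂ _∣_ (sym (d≡⟦bitsOf⟧ i)) ⟦μ⟧≡M (⊆⇒∣ _ μ bitsᵢ⊆μ)))
  ...   | inj₂ (k , αₖ , μₖ) = Row.row-sum-⊈ i k αₖ μₖ

  Λ⊗E≡C : ∀ i j → (Λ N d ⊗ E) i j ≡ Cvec M d i j
  Λ⊗E≡C i zero = begin
    (Λ N d ⊗ E) i zero                 ≡⟨ ⊗≡∑ (Λ N d) E i zero ⟩
    ∑ (λ j → Λ N d i j *ℚ E j zero)    ≡⟨ sum-cong-≗ (Λ*E≡summand i) ⟩
    ∑ (Row.summand i ∘ bitsOf)         ≡⟨ ∑-reindex bitsOf indexOf (Row.summand i) (Row.summand-cong i)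
                                                   indexOf-cong bitsOf-indexOf indexOf-bitsOf ⟩
    ∑ᵇ (Row.summand i)                 ≡⟨ row-sum≡C i ⟩
    Cvec M d i zero                    ∎
    where open ≡-Reasoning

  E-last : ∀ a → toℕ a ≡ 2 ^ n ∸ 1 → E a zero ≡ negOnePow (ω N) *ℚ divQ 24 (φ N * ψ (ndiv N M))
  E-last a a-last = trans (cong (λ o → sgn N o *ℚ K *ℚ divQ o (gcd o M)) (d-first (opposite a) (opposite-last a a-last)))
                          (trans (cong (λ g → negOnePow (ω N) *ℚ K *ℚ divQ 1 g) (gcd-zeroˡ M)) (ℚP.*-identityʳ _))
    where
    K = divQ 24 (φ N * ψ (ndiv N M))

  E-full : M ≡ N → ∀ a → E a zero ≡ sgn N (d (opposite a)) *ℚ divQ 24 (φ N)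
  E-full refl a = trans (cong₂ (λ x y → sgn N o *ℚ divQ 24 x *ℚ y) φN*ψ1≡φN o/o≡1) (ℚP.*-identityʳ _)
    where
    o = d (opposite a)
    N>0 : 0 ℕ.< N
    N>0 = subst (0 ℕ.<_) (sym N≡⟦all⟧) (⟦⟧-pos _)
    N/N≡1 : ndiv N N ≡ 1
    N/N≡1 = trans (cong (λ x → ndiv x N) (sym (ℕP.*-identityʳ N))) (ndiv-*ˡ N 1 N>0)
    φN*ψ1≡φN : φ N * ψ (ndiv N N) ≡ φ N
    φN*ψ1≡φN = trans (cong (λ x → φ N * ψ x) N/N≡1) (ℕP.*-identityʳ (φ N))
    o/o≡1 : divQ o (gcd o N) ≡ 1ℚ
    o/o≡1 = trans (cong (divQ o) (∣-antisym (gcd[m,n]∣m o N) (gcd-greatest ∣-refl (d∣N (opposite a)))))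
                  (divQ-self o (d-pos (opposite a)))

open import Data.Nat using (ℕ; _^_; _∸_; _*_)
open import Data.Nat.Divisibility using (_∣_)
open import Data.Nat.Primality using (Prime)
open import Data.Fin using (Fin; zero; toℕ; opposite; _<_)
open import Data.Product using (∃; _×_)
open import Data.Rational using (ℚ) renaming (_*_ to _*ℚ_)
open import Relation.Binary.PropositionalEquality using (_≡_; _≢_)

open import Data.Product using (_,_)
open import Relation.Binary.PropositionalEquality using (trans)
open RationalSums using (left-inverse-solves)

lemma3p6 : (n : ℕ) (p : Fin n → ℕ)
    → (∀ i → Prime (p i))
    → (∀ i j → p i ≡ p j → i ≡ j)
    → (d : Fin (2 ^ n) → ℕ)
    → (∀ i → d i ∣ prodFin p)
    → (∀ a → a ∣ prodFin p → ∃ λ i → d i ≡ a)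
    → (∀ i j → i < j → d i ≺⟨ p ⟩ d j)
    → (M : ℕ) → M ∣ prodFin p → M ≢ 1
    → (Linv : Matrix (2 ^ n) (2 ^ n))
    → (∀ i j → (Linv ⊗ Λ (prodFin p) d) i j ≡ identity i j)
    → (∀ i j → (Λ (prodFin p) d ⊗ Linv) i j ≡ identity i j)
    → (∀ a → (Linv ⊗ Cvec M d) a zero ≡ Eformula (prodFin p) M d a)
      × (∀ a → toℕ a ≡ 2 ^ n ∸ 1
           → (Linv ⊗ Cvec M d) a zero
             ≡ negOnePow (ω (prodFin p)) *ℚ divQ 24 (φ (prodFin p) * ψ (ndiv (prodFin p) M)))
      × (M ≡ prodFin p
           → ∀ a → (Linv ⊗ Cvec M d) a zero
                   ≡ sgn (prodFin p) (d (opposite a)) *ℚ divQ 24 (φ (prodFin p)))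
lemma3p6 n p p-prime p-injective d d∣N d-onto d-mono M M∣N _ Linv Linv⊗Λ≡I _ =
  solution , (λ a a-last → trans (solution a) (E-last a a-last))
           , (λ M≡N a → trans (solution a) (E-full M≡N a))
  where
  open Solution p p-prime p-injective d d∣N d-onto d-mono M M∣N

  solution : ∀ a → (Linv ⊗ Cvec M d) a zero ≡ Eformula (prodFin p) M d a
  solution a = left-inverse-solves Linv (Λ (prodFin p) d) E (Cvec M d) Linv⊗Λ≡I Λ⊗E≡C a zero
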